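{- Let $k \geq 1$ be an integer and let $G=(V,E)$ be a $2k$-connected graph. Suppose that for every vertex $v$ of $G$ the graph $G$ contains a subdivision of the complete graph $K_{3k-1}$ rooted at $v$. Then $G$ is $k$-linked.
   Context: A graph $G=(V,E)$ is $k$-connected if $|V|>k$ and for every $C\subseteq V$ with $|C|<k$ the graph $G-C$ is connected. $G$ is $k$-linked if $|V|\geq 2k$ and for every choice of $2k$ distinct vertices $s_1,\dots,s_k,t_1,\dots,t_k$ there exist $k$ pairwise vertex-disjoint paths $L_1,\dots,L_k$ with $L_i$ joining $s_i$ and $t_i$. A graph $G'$ is a subdivision of a graph $H$ if it is obtained from $H$ by replacing each edge $uv$ of $H$ by a path with end-vertices $u$ and $v$ (possibly of length one); the vertices of $H$ are the branch vertices. A subdivision (contained in $G$) is rooted at $v$ if its set of branch vertices is $\{v\}\cup U$ with $U$ contained in the neighborhood $N(v)$ of $v$ in $G$. -}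

module Defs where

open import Level using (0ℓ)
open import Data.Nat using (ℕ; _<_; _≤_; _*_; _∸_)
open import Data.Fin using (Fin)
import Data.Fin
open import Data.Fin.Subset using (Subset; _∉_; ∣_∣)
open import Data.List using (List; []; _∷_)
open import Data.List.Membership.Propositional using ()
  renaming (_∈_ to _∈ₗ_; _∉_ to _∉ₗ_)
open import Data.List.Relation.Unary.Unique.Propositional using (Unique)
open import Data.Product using (Σ; ∃; _×_; _,_)
open import Data.Sum using (_⊎_)
open import Relation.Nullary using (¬_)
open import Relation.Binary.PropositionalEquality using (_≡_; _≢_)

record Graph (n : ℕ) : Set₁ where
  field
    Adj     : Fin n → Fin n → Set
    sym     : ∀ {u v} → Adj u v → Adj v u
    irrefl  : ∀ {u} → ¬ Adj u u

module _ {n : ℕ} (G : Graph n) where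
  open Graph G

  data Walk : Fin n → Fin n → List (Fin n) → Set where
    here : ∀ {u} → Walk u u (u ∷ [])
    step : ∀ {u w v xs} → Adj u w → Walk w v xs → Walk u v (u ∷ xs)

  IsPath : Fin n → Fin n → List (Fin n) → Set
  IsPath u v xs = Walk u v xs × Unique xs

  ConnectedMinus : Subset n → Set
  ConnectedMinus C =
    ∀ u v → u ∉ C → v ∉ C →
      Σ (List (Fin n)) λ xs → IsPath u v xs × (∀ x → x ∈ₗ xs → x ∉ C)

  KConnected : ℕ → Set
  KConnected k = k < n × (∀ (C : Subset n) → ∣ C ∣ < k → ConnectedMinus C)

  KLinked : ℕ → Set
  KLinked k = (k * 2 ≤ n) ×
    (∀ (s t : Fin k → Fin n) →
      (∀ i j → s i ≡ s j → i ≡ j) →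
      (∀ i j → t i ≡ t j → i ≡ j) →
      (∀ i j → s i ≢ t j) →
      Σ (Fin k → List (Fin n)) λ L →
        (∀ i → IsPath (s i) (t i) (L i)) ×
        (∀ i j → i ≢ j → ∀ x → x ∈ₗ L i → x ∉ₗ L j))

  -- A subdivision of the complete graph K_m contained in G: injective
  -- branch map b, and for every pair i < j a path P i j joining b i and b j;
  -- a branch vertex on P i j is an end of it, and two distinct such paths
  -- share only branch vertices (i.e. they are internally disjoint).
  record SubdivK (m : ℕ) : Set where
    field
      b       : Fin m → Fin n
      b-inj   : ∀ i j → b i ≡ b j → i ≡ j
      P       : Fin m → Fin m → List (Fin n)
      P-path  : ∀ i j → i Data.Fin.< j → IsPath (b i) (b j) (P i j)
      P-ends  : ∀ i j → i Data.Fin.< j → ∀ l → b l ∈ₗ P i j → l ≡ i ⊎ l ≡ j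
      P-disj  : ∀ i j i′ j′ → i Data.Fin.< j → i′ Data.Fin.< j′ →
                ¬ (i ≡ i′ × j ≡ j′) →
                ∀ x → x ∈ₗ P i j → x ∈ₗ P i′ j′ → ∃ λ l → x ≡ b l

  RootedSubdivK : ℕ → Fin n → Set
  RootedSubdivK m v = Σ (SubdivK m) λ S →
    let open SubdivK S in
    ∃ λ r → b r ≡ v × (∀ i → i ≢ r → Adj v (b i))

-- Root a subdivision of K_{3k-1} at s₀; its branch vertex s₀ = b r is adjacent to all others. As
-- G is 2k-connected and there are 3k - 1 ≥ 2k branch vertices, Menger's theorem yields 2k disjoint
-- routes from the terminals to distinct branch vertices, meeting branch vertices only at their ends
-- (the route of s₀ is trivial). Choose such routes using as few edges off the subdivision paths as
-- possible. Each of the k - 1 unused branch vertices c serves one pair s_l, t_l (l ≥ 1): walking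
-- from c along the subdivision path towards the end of the route of s_l, the first route met is
-- that of s_l, since otherwise the route met could be diverted along this path to c more cheaply;
-- likewise for t_l, and these two walks from c join s_l to t_l. Finally s₀ is joined to t₀ by the
-- edge from s₀ to the end of the route of t₀.
--
-- Menger's theorem is proved by contracting edges, and only up to double negation; the double
-- negation is removed at the end because linkedness is decidable in the finite subgraph formed by
-- the edges the argument uses (adjacency in G itself need not be decidable).

module Submission where

open import Defs
open import Data.Nat using (ℕ; zero; suc; _≤_; _<_; _+_; _*_; _∸_; s≤s)
import Data.Nat.Properties as ℕ
open import Data.Fin as Fin using (Fin; zero; suc; punchIn; punchOut; _↑ˡ_; _↑ʳ_)
import Data.Fin.Properties as Fin
open import Data.Fin.Subset as Subset using (Subset; ⁅_⁆; _∪_; ∣_∣; inside; outside)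
import Data.Fin.Subset.Properties as Subset
open import Data.Bool using (Bool; true; false)
open import Data.Vec as Vec using (Vec; []; _∷_)
import Data.Vec.Properties as Vec
open import Data.List using (List; []; _∷_; _++_; length; map; concatMap; filter; allFin; deduplicate; lookup)
open import Data.List.Properties using (length-map; length-tabulate; length-deduplicate)
open import Data.List.Membership.Propositional using (_∈_; _∉_; find; lose)
open import Data.List.Membership.Propositional.Properties
  using (∈-map⁺; ∈-map⁻; ∈-allFin; ∈-lookup; ∈-deduplicate⁺; ∈-filter⁻; ∈-concat⁺′; ∈-++⁺ˡ; ∈-++⁺ʳ)
open import Data.List.Relation.Unary.Any using (Any; here; there; index)
import Data.List.Relation.Unary.Any as Any
open import Data.List.Relation.Unary.Any.Properties using (lookup-index)
import Data.List.Relation.Unary.All as All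
open import Data.List.Relation.Unary.All.Properties using (¬Any⇒All¬)
open import Data.List.Relation.Unary.Unique.Propositional using (Unique; []; _∷_)
import Data.List.Relation.Unary.Unique.Propositional.Properties as Unique
open import Data.List.Relation.Unary.Unique.DecPropositional.Properties using (deduplicate-!)
open import Data.Product as Product using (Σ; ∃; _×_; _,_; proj₁; proj₂; Σ-syntax; uncurry)
open import Data.Product.Properties using (≡-dec)
open import Data.Sum using (_⊎_; inj₁; inj₂; [_,_]′)
open import Data.Empty using (⊥; ⊥-elim)
open import Data.Unit using (⊤; tt)
open import Function using (_∘_; case_of_)
open import Function.Definitions using (Injective)
open import Relation.Nullary using (¬_; Dec; yes; no; ¬?)
open import Relation.Nullary.Decidable using (_×-dec_; _⊎-dec_; _→-dec_; map′; decidable-stable)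
open import Relation.Unary using (Decidable)
open import Relation.Binary.Definitions using (tri<; tri≈; tri>)
open import Relation.Binary.PropositionalEquality using (_≡_; _≢_; refl; sym; trans; cong; cong₂; subst)
open import Relation.Binary.Construct.Closure.ReflexiveTransitive using (Star; ε; _◅_; _◅◅_; revApp; reverse)
import Relation.Binary.Construct.Closure.ReflexiveTransitive as Star

-- Walks

module _ {V : Set} where

  private
    variable
      R R′ : V → V → Set
      u u′ v w x : V

  vertices : Star R u v → List V
  vertices {u = u} ε = u ∷ []
  vertices (_◅_ {u} _ p) = u ∷ vertices p

  source∈ : (p : Star R u v) → u ∈ vertices p
  source∈ ε = here refl
  source∈ (_ ◅ _) = here refl

  target∈ : (p : Star R u v) → v ∈ vertices p
  target∈ ε = here refl
  target∈ (_ ◅ p) = there (target∈ p)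

  ∈-◅◅⁻ : (p : Star R u v) (q : Star R v w) →
          x ∈ vertices (p ◅◅ q) → x ∈ vertices p ⊎ x ∈ vertices q
  ∈-◅◅⁻ ε q m = inj₂ m
  ∈-◅◅⁻ (r ◅ p) q (here eq) = inj₁ (here eq)
  ∈-◅◅⁻ (r ◅ p) q (there m) with ∈-◅◅⁻ p q m
  ... | inj₁ m′ = inj₁ (there m′)
  ... | inj₂ m′ = inj₂ m′

  ∈-◅◅⁺ˡ : (p : Star R u v) (q : Star R v w) → x ∈ vertices p → x ∈ vertices (p ◅◅ q)
  ∈-◅◅⁺ˡ ε q (here refl) = source∈ q
  ∈-◅◅⁺ˡ (r ◅ p) q (here eq) = here eq
  ∈-◅◅⁺ˡ (r ◅ p) q (there m) = there (∈-◅◅⁺ˡ p q m)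

  ∈-◅◅⁺ʳ : (p : Star R u v) (q : Star R v w) → x ∈ vertices q → x ∈ vertices (p ◅◅ q)
  ∈-◅◅⁺ʳ ε q m = m
  ∈-◅◅⁺ʳ (r ◅ p) q m = there (∈-◅◅⁺ʳ p q m)

  vertices-subst : (e : u ≡ u′) (p : Star R u v) → vertices (subst (λ s → Star R s v) e p) ≡ vertices p
  vertices-subst refl p = refl

  ∈-split⁺ˡ : {p : Star R u w} (α : Star R u v) (β : Star R v w) → p ≡ α ◅◅ β →
              x ∈ vertices α → x ∈ vertices p
  ∈-split⁺ˡ α β refl = ∈-◅◅⁺ˡ α β

  ∈-split⁺ʳ : {p : Star R u w} (α : Star R u v) (β : Star R v w) → p ≡ α ◅◅ β →
              x ∈ vertices β → x ∈ vertices p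
  ∈-split⁺ʳ α β refl = ∈-◅◅⁺ʳ α β

  splitAtVertex : (p : Star R u v) → x ∈ vertices p →
                  Σ[ α ∈ Star R u x ] Σ[ β ∈ Star R x v ] p ≡ α ◅◅ β
  splitAtVertex ε (here refl) = ε , ε , refl
  splitAtVertex (r ◅ p) (here refl) = ε , r ◅ p , refl
  splitAtVertex (r ◅ p) (there m) with splitAtVertex p m
  ... | α , β , eq = r ◅ α , β , cong (r ◅_) eq

  vertices-map : (f : ∀ {a b} → R a b → R′ a b) (p : Star R u v) →
                 vertices (Star.map f p) ≡ vertices p
  vertices-map f ε = refl
  vertices-map f (r ◅ p) = cong (_ ∷_) (vertices-map f p)

  module _ (s : ∀ {a b} → R a b → R′ b a) where

    ∈-revApp⁻ : (p : Star R v u) (q : Star R′ v w) →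
                x ∈ vertices (revApp s p q) → x ∈ vertices p ⊎ x ∈ vertices q
    ∈-revApp⁻ ε q m = inj₂ m
    ∈-revApp⁻ (r ◅ p) q m with ∈-revApp⁻ p (s r ◅ q) m
    ... | inj₁ m′ = inj₁ (there m′)
    ... | inj₂ (here refl) = inj₁ (there (source∈ p))
    ... | inj₂ (there m′) = inj₂ m′

  module _ (s : ∀ {a b} → R a b → R b a) where

    ∈-reverse⁻ : (p : Star R u v) → x ∈ vertices (reverse s p) → x ∈ vertices p
    ∈-reverse⁻ p m with ∈-revApp⁻ s p ε m
    ... | inj₁ m′ = m′
    ... | inj₂ (here refl) = source∈ p

  Avoids : (V → Set) → Star R u v → Set
  Avoids D p = ∀ x → x ∈ vertices p → ¬ D x

  AvoidsButTarget : (V → Set) → Star R u v → Set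
  AvoidsButTarget D ε = ⊤
  AvoidsButTarget D (_◅_ {u} _ p) = ¬ D u × AvoidsButTarget D p

  AvoidsButSource : (V → Set) → Star R u v → Set
  AvoidsButSource D ε = ⊤
  AvoidsButSource D (_ ◅ p) = Avoids D p

  module _ {D : V → Set} where

    avoidsButTarget-◅◅ˡ : (α : Star R u v) (β : Star R v w) →
                           AvoidsButTarget D (α ◅◅ β) → AvoidsButTarget D α
    avoidsButTarget-◅◅ˡ ε β a = tt
    avoidsButTarget-◅◅ˡ (r ◅ α) β (d , a) = d , avoidsButTarget-◅◅ˡ α β a

    avoidsButTarget-◅◅ʳ : (α : Star R u v) (β : Star R v w) →
                           AvoidsButTarget D (α ◅◅ β) → AvoidsButTarget D β
    avoidsButTarget-◅◅ʳ ε β a = a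
    avoidsButTarget-◅◅ʳ (r ◅ α) β (d , a) = avoidsButTarget-◅◅ʳ α β a

    avoidsButSource-◅◅ʳ : (α : Star R u v) (β : Star R v w) →
                           AvoidsButSource D (α ◅◅ β) → AvoidsButSource D β
    avoidsButSource-◅◅ʳ ε β a = a
    avoidsButSource-◅◅ʳ (r ◅ α) ε a = tt
    avoidsButSource-◅◅ʳ (r ◅ α) (r′ ◅ β) a x m = a x (∈-◅◅⁺ʳ α (r′ ◅ β) (there m))

    avoidsButTarget⇒avoids : (p : Star R u v) → AvoidsButTarget D p → ¬ D v → Avoids D p
    avoidsButTarget⇒avoids ε a ¬d x (here refl) = ¬d
    avoidsButTarget⇒avoids (r ◅ p) (d , a) ¬d x (here refl) = d
    avoidsButTarget⇒avoids (r ◅ p) (d , a) ¬d x (there m) = avoidsButTarget⇒avoids p a ¬d x m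

    avoidsButSource⇒avoids : (p : Star R u v) → AvoidsButSource D p → ¬ D u → Avoids D p
    avoidsButSource⇒avoids ε a ¬d x (here refl) = ¬d
    avoidsButSource⇒avoids (r ◅ p) a ¬d x (here refl) = ¬d
    avoidsButSource⇒avoids (r ◅ p) a ¬d x (there m) = a x m

    avoidsButTarget-hit : (p : Star R u v) → AvoidsButTarget D p → x ∈ vertices p → D x → x ≡ v
    avoidsButTarget-hit ε a (here refl) d = refl
    avoidsButTarget-hit (r ◅ p) (¬d , a) (here refl) d = ⊥-elim (¬d d)
    avoidsButTarget-hit (r ◅ p) (¬d , a) (there m) d = avoidsButTarget-hit p a m d

    avoidsButSource-hit : (p : Star R u v) → AvoidsButSource D p → x ∈ vertices p → D x → x ≡ u
    avoidsButSource-hit ε a (here refl) d = refl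
    avoidsButSource-hit (r ◅ p) a (here refl) d = refl
    avoidsButSource-hit (r ◅ p) a (there m) d = ⊥-elim (a _ m d)

    module _ (D? : ∀ x → Dec (D x)) where

      splitAtFirst : (p : Star R u v) → Any D (vertices p) →
                     Σ[ x ∈ V ] D x × Σ[ α ∈ Star R u x ] Σ[ β ∈ Star R x v ]
                       p ≡ α ◅◅ β × AvoidsButTarget D α
      splitAtFirst ε (here d) = _ , d , ε , ε , refl , tt
      splitAtFirst (_◅_ {u} r p) h with D? u
      ... | yes d = u , d , ε , r ◅ p , refl , tt
      splitAtFirst (r ◅ p) (here d) | no ¬d = ⊥-elim (¬d d)
      splitAtFirst (r ◅ p) (there h) | no ¬d with splitAtFirst p h
      ... | x , d , α , β , eq , a = x , d , r ◅ α , β , cong (r ◅_) eq , ¬d , a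

      splitAtLast : (p : Star R u v) → Any D (vertices p) →
                    Σ[ x ∈ V ] D x × Σ[ α ∈ Star R u x ] Σ[ β ∈ Star R x v ]
                      p ≡ α ◅◅ β × AvoidsButSource D β
      splitAtLast ε (here d) = _ , d , ε , ε , refl , tt
      splitAtLast (_◅_ {u} r p) h with Any.any? D? (vertices p)
      ... | yes h′ with splitAtLast p h′
      ...   | x , d , α , β , eq , a = x , d , r ◅ α , β , cong (r ◅_) eq , a
      splitAtLast (r ◅ p) (here d) | no ¬h =
        _ , d , ε , r ◅ p , refl , λ x m d′ → ¬h (lose m d′)
      splitAtLast (r ◅ p) (there h) | no ¬h = ⊥-elim (¬h h)

  AllSteps : (V → V → Set) → Star R u v → Set
  AllSteps Q ε = ⊤
  AllSteps Q (_◅_ {u} {w} _ p) = Q u w × AllSteps Q p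

  module _ {Q : V → V → Set} where

    allSteps-◅◅ˡ : (α : Star R u v) (β : Star R v w) → AllSteps Q (α ◅◅ β) → AllSteps Q α
    allSteps-◅◅ˡ ε β _ = tt
    allSteps-◅◅ˡ (r ◅ α) β (q , a) = q , allSteps-◅◅ˡ α β a

    allSteps-revApp : (s : ∀ {a b} → R a b → R b a) → (∀ {a b} → Q a b → Q b a) →
                      (p : Star R v u) (q : Star R v w) →
                      AllSteps Q p → AllSteps Q q → AllSteps Q (revApp s p q)
    allSteps-revApp s sym-Q ε q _ aq = aq
    allSteps-revApp s sym-Q (r ◅ p) q (h , ap) aq = allSteps-revApp s sym-Q p (s r ◅ q) ap (sym-Q h , aq)

    allSteps-reverse : (s : ∀ {a b} → R a b → R b a) → (∀ {a b} → Q a b → Q b a) →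
                       (p : Star R u v) → AllSteps Q p → AllSteps Q (reverse s p)
    allSteps-reverse s sym-Q p ap = allSteps-revApp s sym-Q p ε ap tt

    allSteps-mono : ∀ {Q′ : V → V → Set} → (∀ {a b} → Q a b → Q′ a b) →
                    (p : Star R u v) → AllSteps Q p → AllSteps Q′ p
    allSteps-mono f ε _ = tt
    allSteps-mono f (r ◅ p) (q , a) = f q , allSteps-mono f p a

    module _ (Q? : ∀ a b → Dec (Q a b)) where

      private
        missed : ∀ {A : Set} → Dec A → ℕ
        missed (yes _) = 0
        missed (no _) = 1

      stepsOutside : Star R u v → ℕ
      stepsOutside ε = 0
      stepsOutside (_◅_ {u} {w} _ p) = missed (Q? u w) + stepsOutside p

      stepsOutside-◅◅ : (α : Star R u v) (β : Star R v w) →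
                        stepsOutside (α ◅◅ β) ≡ stepsOutside α + stepsOutside β
      stepsOutside-◅◅ ε β = refl
      stepsOutside-◅◅ (_◅_ {u} {w} r α) β =
        trans (cong (missed (Q? u w) +_) (stepsOutside-◅◅ α β)) (sym (ℕ.+-assoc (missed (Q? u w)) _ _))

      allSteps⇒stepsOutside≡0 : (p : Star R u v) → AllSteps Q p → stepsOutside p ≡ 0
      allSteps⇒stepsOutside≡0 ε _ = refl
      allSteps⇒stepsOutside≡0 (_◅_ {u} {w} _ p) (q , a) with Q? u w
      ... | yes _ = allSteps⇒stepsOutside≡0 p a
      ... | no ¬q = ⊥-elim (¬q q)

      stepsOutside≡0⇒allSteps : (p : Star R u v) → stepsOutside p ≡ 0 → AllSteps Q p
      stepsOutside≡0⇒allSteps ε _ = tt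
      stepsOutside≡0⇒allSteps (_◅_ {u} {w} _ p) e with Q? u w
      ... | yes q = q , stepsOutside≡0⇒allSteps p e

module _ {V W : Set} {R : V → V → Set} {S : W → W → Set} where

  vertices-gmap : (f : V → W) (g : ∀ {a b} → R a b → S (f a) (f b)) → ∀ {u v} (p : Star R u v) →
                  vertices (Star.gmap {U = S} f g p) ≡ map f (vertices p)
  vertices-gmap f g ε = refl
  vertices-gmap f g (r ◅ p) = cong (_ ∷_) (vertices-gmap f g p)

-- Menger's theorem for graphs given by edge lists

Edge : ℕ → Set
Edge n = Fin n × Fin n

_∈?_ : ∀ {n} (v : Fin n) (xs : List (Fin n)) → Dec (v ∈ xs)
v ∈? xs = Any.any? (v Fin.≟_) xs

module _ {n : ℕ} where

  -- Steps may stay at a vertex, so that contracting an edge maps walks to walks.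
  ReflAdj : List (Edge n) → Fin n → Fin n → Set
  ReflAdj E u v = u ≡ v ⊎ (u , v) ∈ E ⊎ (v , u) ∈ E

  EWalk : List (Edge n) → Fin n → Fin n → Set
  EWalk E = Star (ReflAdj E)

  reflAdj-sym : ∀ {E u v} → ReflAdj E u v → ReflAdj E v u
  reflAdj-sym (inj₁ refl) = inj₁ refl
  reflAdj-sym (inj₂ (inj₁ m)) = inj₂ (inj₂ m)
  reflAdj-sym (inj₂ (inj₂ m)) = inj₂ (inj₁ m)

  reflAdj-mono : ∀ {E E′} → (∀ {e} → e ∈ E → e ∈ E′) → ∀ {u v} → ReflAdj E u v → ReflAdj E′ u v
  reflAdj-mono f (inj₁ eq) = inj₁ eq
  reflAdj-mono f (inj₂ (inj₁ m)) = inj₂ (inj₁ (f m))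
  reflAdj-mono f (inj₂ (inj₂ m)) = inj₂ (inj₂ (f m))

  reflAdj-swap : ∀ {x y : Fin n} {E u v} → ReflAdj ((x , y) ∷ E) u v → ReflAdj ((y , x) ∷ E) u v
  reflAdj-swap (inj₁ e) = inj₁ e
  reflAdj-swap (inj₂ (inj₁ (here refl))) = inj₂ (inj₂ (here refl))
  reflAdj-swap (inj₂ (inj₁ (there m))) = inj₂ (inj₁ (there m))
  reflAdj-swap (inj₂ (inj₂ (here refl))) = inj₂ (inj₁ (here refl))
  reflAdj-swap (inj₂ (inj₂ (there m))) = inj₂ (inj₂ (there m))

  Disjoint : ∀ {k} {R : Fin n → Fin n → Set} {a z : Fin k → Fin n} → (∀ i → Star R (a i) (z i)) → Set
  Disjoint W = ∀ i j → i ≢ j → ∀ x → x ∈ vertices (W i) → x ∉ vertices (W j)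

  record Linkage {k} (E : List (Edge n)) (a : Fin k → Fin n) (B : Fin n → Set) : Set where
    field
      target   : Fin k → Fin n
      walk     : ∀ i → EWalk E (a i) (target i)
      target∈B : ∀ i → B (target i)
      disjoint : Disjoint walk

  Separates : ∀ {k} → List (Edge n) → (Fin k → Fin n) → (Fin n → Set) → List (Fin n) → Set
  Separates E a B S = ∀ i v → B v → (p : EWalk E (a i) v) → ¬ Avoids (_∈ S) p

  NoSmallSeparator : ∀ {k} → List (Edge n) → (Fin k → Fin n) → (Fin n → Set) → Set
  NoSmallSeparator {k} E a B = ∀ S → length S < k → ¬ Separates E a B S

  MengerFor : List (Edge n) → Set₁
  MengerFor E = ∀ {k} (a : Fin k → Fin n) → Injective _≡_ _≡_ a → (B : Fin n → Set) → Decidable B →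
                NoSmallSeparator E a B → ¬ ¬ Linkage E a B

  linkage-map : ∀ {E E′ k} {a : Fin k → Fin n} {B} → (∀ {u v} → ReflAdj E u v → ReflAdj E′ u v) →
                Linkage E a B → Linkage E′ a B
  linkage-map f L = record
    { target = target ; walk = λ i → Star.map f (walk i) ; target∈B = target∈B
    ; disjoint = λ i j i≢j x m m′ →
        disjoint i j i≢j x (subst (x ∈_) (vertices-map f (walk i)) m) (subst (x ∈_) (vertices-map f (walk j)) m′) }
    where open Linkage L

  separates-map : ∀ {E E′ k} {a : Fin k → Fin n} {B S} → (∀ {u v} → ReflAdj E u v → ReflAdj E′ u v) →
                  Separates E′ a B S → Separates E a B S
  separates-map f sep i v b p av = sep i v b (Star.map f p) λ x m → av x (subst (x ∈_) (vertices-map f p) m)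

  weaken : ∀ {e E u v} → EWalk E u v → EWalk (e ∷ E) u v
  weaken = Star.map (reflAdj-mono there)

  vertices-weaken : ∀ {e E u v} (p : EWalk E u v) → vertices (weaken {e} p) ≡ vertices p
  vertices-weaken = vertices-map (reflAdj-mono there)

  walk[]⇒≡ : ∀ {u v} → EWalk [] u v → u ≡ v
  walk[]⇒≡ ε = refl
  walk[]⇒≡ (inj₁ refl ◅ p) = walk[]⇒≡ p
  walk[]⇒≡ (inj₂ (inj₁ ()) ◅ p)
  walk[]⇒≡ (inj₂ (inj₂ ()) ◅ p)

  -- Without edges, a missing source a i ∉ B would be separated from B by the other k - 1 sources.
  linkage-[] : ∀ {k} (a : Fin k → Fin n) → Injective _≡_ _≡_ a → (B : Fin n → Set) → Decidable B →
               NoSmallSeparator [] a B → Linkage [] a B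
  linkage-[] {zero} a a-inj B B? noSep = record { target = a ; walk = λ () ; target∈B = λ () ; disjoint = λ () }
  linkage-[] {suc k′} a a-inj B B? noSep = record
    { target = a ; walk = λ i → ε ; target∈B = source∈B
    ; disjoint = λ { i j i≢j x (here refl) (here e) → i≢j (a-inj e) } }
    where
    source∈B : ∀ i → B (a i)
    source∈B i with B? (a i)
    ... | yes b = b
    ... | no ¬b = ⊥-elim (noSep others (s≤s (ℕ.≤-reflexive |others|)) separates)
      where
      others : List (Fin n)
      others = map (a ∘ punchIn i) (allFin k′)
      |others| : length others ≡ k′
      |others| = trans (length-map _ (allFin k′)) (length-tabulate _)
      separates : Separates [] a B others
      separates j v b p av with walk[]⇒≡ p
      ... | refl with j Fin.≟ i
      ...   | yes refl = ¬b b
      ...   | no j≢i = av (a j) (source∈ p)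
          (subst (λ l → a l ∈ others) (Fin.punchIn-punchOut (j≢i ∘ sym))
            (∈-map⁺ (a ∘ punchIn i) (∈-allFin (punchOut (j≢i ∘ sym)))))

module _ {n : ℕ} where

  module DeleteEdge {x y : Fin n} {E : List (Edge n)} {D : Fin n → Set} (Dx : D x) (Dy : D y) where

    private
      leaving : ∀ {u w} → ¬ D u → ReflAdj ((x , y) ∷ E) u w → ReflAdj E u w
      leaving ¬d (inj₁ e) = inj₁ e
      leaving ¬d (inj₂ (inj₁ (here refl))) = ⊥-elim (¬d Dx)
      leaving ¬d (inj₂ (inj₁ (there m))) = inj₂ (inj₁ m)
      leaving ¬d (inj₂ (inj₂ (here refl))) = ⊥-elim (¬d Dy)
      leaving ¬d (inj₂ (inj₂ (there m))) = inj₂ (inj₂ m)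

      entering : ∀ {u w} → ¬ D w → ReflAdj ((x , y) ∷ E) u w → ReflAdj E u w
      entering ¬d r = reflAdj-sym (leaving ¬d (reflAdj-sym r))

    WalkWithout : ∀ {u v} → EWalk ((x , y) ∷ E) u v → Set
    WalkWithout {u} {v} p = Σ[ q ∈ EWalk E u v ] vertices q ≡ vertices p

    without-avoids : ∀ {u v} (p : EWalk ((x , y) ∷ E) u v) → Avoids D p → WalkWithout p
    without-avoids ε _ = ε , refl
    without-avoids (r ◅ p) av with without-avoids p (λ z m → av z (there m))
    ... | q , e = leaving (av _ (here refl)) r ◅ q , cong (_ ∷_) e

    without-avoidsButTarget : ∀ {u v} (p : EWalk ((x , y) ∷ E) u v) → AvoidsButTarget D p → WalkWithout p
    without-avoidsButTarget ε _ = ε , refl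
    without-avoidsButTarget (r ◅ p) (¬d , av) with without-avoidsButTarget p av
    ... | q , e = leaving ¬d r ◅ q , cong (_ ∷_) e

    without-avoidsButSource : ∀ {u v} (p : EWalk ((x , y) ∷ E) u v) → AvoidsButSource D p → WalkWithout p
    without-avoidsButSource ε _ = ε , refl
    without-avoidsButSource (r ◅ p) av with without-avoids p av
    ... | q , e = entering (av _ (source∈ p)) r ◅ q , cong (_ ∷_) e

  -- If X separates a from B, an a–X linkage and an X–B linkage avoiding e combine into an a–B linkage.
  module ThroughSeparator {e : Edge n} {E : List (Edge n)} {k} {a : Fin k → Fin n} {B : Fin n → Set}
    (X : List (Fin n)) (x : Fin k → Fin n) (x-inj : Injective _≡_ _≡_ x)
    (∈X⇒ : ∀ {z} → z ∈ X → ∃ λ j → x j ≡ z) (X-separates : Separates (e ∷ E) a B X) where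

    module _ (L₁ : Linkage E a (_∈ X)) (L₂ : Linkage E x B) where
      open Linkage L₁ renaming (walk to walk₁; target∈B to target∈X; disjoint to disjoint₁)
      open Linkage L₂
        renaming (target to target₂; walk to walk₂; target∈B to target∈B₂; disjoint to disjoint₂)

      record Head (i : Fin k) : Set where
        field
          σ       : Fin k
          α       : EWalk E (a i) (x σ)
          α⊆      : ∀ w → w ∈ vertices α → w ∈ vertices (walk₁ i)
          α-avoids : AvoidsButTarget (_∈ X) α

      record Tail (j : Fin k) : Set where
        field
          β       : EWalk E (x j) (target₂ j)
          β⊆      : ∀ w → w ∈ vertices β → w ∈ vertices (walk₂ j)
          β-avoids : AvoidsButSource (_∈ X) β

      abstract
        head : ∀ i → Head i
        head i with splitAtFirst (_∈? X) (walk₁ i) (lose (target∈ (walk₁ i)) (target∈X i))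
        ... | _ , z∈X , α , β , eq , av with ∈X⇒ z∈X
        ...   | j , refl = record { σ = j ; α = α ; α⊆ = λ w → ∈-split⁺ˡ α β eq ; α-avoids = av }

        -- After the last visit of x j, the walk walk₂ j meets X nowhere else: the other x j′ lie on other walks.
        tail : ∀ j → Tail j
        tail j with splitAtLast (Fin._≟ x j) (walk₂ j) (lose (source∈ (walk₂ j)) refl)
        ... | _ , refl , α , β , eq , av =
          record { β = β ; β⊆ = λ w → ∈-split⁺ʳ α β eq
                 ; β-avoids = onlySource β (λ w → ∈-split⁺ʳ α β eq) av }
          where
          onlySource : ∀ {t} (β : EWalk E (x j) t) → (∀ w → w ∈ vertices β → w ∈ vertices (walk₂ j)) →
                       AvoidsButSource (_≡ x j) β → AvoidsButSource (_∈ X) β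
          onlySource ε _ _ = tt
          onlySource (r ◅ β′) β⊆ av w m w∈X with ∈X⇒ w∈X
          ... | j′ , refl with j′ Fin.≟ j
          ...   | yes refl = av (x j) m refl
          ...   | no j′≢j =
            disjoint₂ j j′ (j′≢j ∘ sym) (x j′) (β⊆ _ (there m)) (source∈ (walk₂ j′))

      open Head
      open Tail

      σ-injective : ∀ i i′ → i ≢ i′ → σ (head i) ≢ σ (head i′)
      σ-injective i i′ i≢i′ eq = disjoint₁ i i′ i≢i′ _ (α⊆ (head i) _ (target∈ (α (head i))))
        (subst (λ j → x j ∈ vertices (walk₁ i′)) (sym eq) (α⊆ (head i′) _ (target∈ (α (head i′)))))

      -- A common vertex outside X would give a walk from a i to B avoiding X.
      head-tail-disjoint : ∀ i i′ → i ≢ i′ →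
                           ∀ w → w ∈ vertices (α (head i)) → w ∉ vertices (β (tail (σ (head i′))))
      head-tail-disjoint i i′ i≢i′ w m m′ with w ∈? X
      ... | yes w∈X = σ-injective i i′ i≢i′ (x-inj (trans
            (sym (avoidsButTarget-hit (α (head i)) (α-avoids (head i)) m w∈X))
            (avoidsButSource-hit (β (tail _)) (β-avoids (tail _)) m′ w∈X)))
      ... | no w∉X with splitAtVertex (α (head i)) m | splitAtVertex (β (tail (σ (head i′)))) m′
      ...   | α₁ , α₂ , eqα | β₁ , β₂ , eqβ =
        X-separates i _ (target∈B₂ _) (weaken (α₁ ◅◅ β₂)) λ u u∈ → [ avoidsα₁ u , avoidsβ₂ u ]′
          (∈-◅◅⁻ α₁ β₂ (subst (u ∈_) (vertices-weaken (α₁ ◅◅ β₂)) u∈))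
        where
        avoidsα₁ : Avoids (_∈ X) α₁
        avoidsα₁ = avoidsButTarget⇒avoids α₁
          (avoidsButTarget-◅◅ˡ α₁ α₂ (subst (AvoidsButTarget (_∈ X)) eqα (α-avoids (head i)))) w∉X
        avoidsβ₂ : Avoids (_∈ X) β₂
        avoidsβ₂ = avoidsButSource⇒avoids β₂
          (avoidsButSource-◅◅ʳ β₁ β₂ (subst (AvoidsButSource (_∈ X)) eqβ (β-avoids (tail _)))) w∉X

      walkᵢ : ∀ i → EWalk E (a i) (target₂ (σ (head i)))
      walkᵢ i = α (head i) ◅◅ β (tail (σ (head i)))

      disjointᵢ : Disjoint (λ i → weaken {e = e} (walkᵢ i))
      disjointᵢ i i′ i≢i′ w m m′
        with ∈-◅◅⁻ (α (head i)) _ (subst (w ∈_) (vertices-weaken (walkᵢ i)) m)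
           | ∈-◅◅⁻ (α (head i′)) _ (subst (w ∈_) (vertices-weaken (walkᵢ i′)) m′)
      ... | inj₁ h | inj₁ h′ = disjoint₁ i i′ i≢i′ w (α⊆ (head i) w h) (α⊆ (head i′) w h′)
      ... | inj₂ t | inj₂ t′ =
        disjoint₂ _ _ (σ-injective i i′ i≢i′) w (β⊆ (tail _) w t) (β⊆ (tail _) w t′)
      ... | inj₁ h | inj₂ t′ = head-tail-disjoint i i′ i≢i′ w h t′
      ... | inj₂ t | inj₁ h′ = head-tail-disjoint i′ i (i≢i′ ∘ sym) w h′ t

      combine : Linkage (e ∷ E) a B
      combine = record
        { target = λ i → target₂ (σ (head i)) ; walk = λ i → weaken (walkᵢ i)
        ; target∈B = λ i → target∈B₂ (σ (head i)) ; disjoint = disjointᵢ }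

lookup-injective : ∀ {A : Set} {xs : List A} → Unique xs → Injective _≡_ _≡_ (lookup xs)
lookup-injective {xs = x ∷ xs} (x∉ ∷ u) {zero} {zero} eq = refl
lookup-injective {xs = x ∷ xs} (x∉ ∷ u) {zero} {suc j} eq = ⊥-elim (All.lookup x∉ (∈-lookup j) eq)
lookup-injective {xs = x ∷ xs} (x∉ ∷ u) {suc i} {zero} eq = ⊥-elim (All.lookup x∉ (∈-lookup i) (sym eq))
lookup-injective {xs = x ∷ xs} (x∉ ∷ u) {suc i} {suc j} eq = cong suc (lookup-injective u eq)

module _ {n : ℕ} where

  MengerUpTo : ℕ → Set₁
  MengerUpTo N = (E : List (Edge n)) → length E ≤ N → MengerFor E

  -- A separator of size exactly k containing both ends of e splits the instance into an a–X and an
  -- X–B instance without e, each of which is solved by the induction hypothesis.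
  linkage-via-separator : ∀ {x y E k} → MengerFor E → {a : Fin k → Fin n} → Injective _≡_ _≡_ a →
    {B : Fin n → Set} → Decidable B → NoSmallSeparator ((x , y) ∷ E) a B →
    (X : List (Fin n)) → Unique X → length X ≡ k → x ∈ X → y ∈ X → Separates ((x , y) ∷ E) a B X →
    ¬ ¬ Linkage ((x , y) ∷ E) a B
  linkage-via-separator {x} {y} {E} {k} IH {a} a-inj {B} B? noSep X X! |X|≡k x∈X y∈X X-separates ¬L =
    IH a a-inj (_∈ X) (_∈? X) noSepᵃ λ L₁ → IH xs xs-inj B B? noSepᵇ λ L₂ →
      ¬L (ThroughSeparator.combine X xs xs-inj ∈X⇒ X-separates L₁ L₂)
    where
    open DeleteEdge {E = E} {D = _∈ X} x∈X y∈X

    xs : Fin k → Fin n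
    xs j = lookup X (Fin.cast (sym |X|≡k) j)

    xs-inj : Injective _≡_ _≡_ xs
    xs-inj {i} {j} eq = trans (sym (Fin.cast-involutive |X|≡k (sym |X|≡k) i))
      (trans (cong (Fin.cast |X|≡k) (lookup-injective X! eq)) (Fin.cast-involutive |X|≡k (sym |X|≡k) j))

    ∈X⇒ : ∀ {z} → z ∈ X → ∃ λ j → xs j ≡ z
    ∈X⇒ z∈X = Fin.cast |X|≡k (index z∈X) ,
      trans (cong (lookup X) (Fin.cast-involutive (sym |X|≡k) |X|≡k (index z∈X))) (sym (lookup-index z∈X))

    noSepᵃ : NoSmallSeparator E a (_∈ X)
    noSepᵃ T |T|<k T-sep = noSep T |T|<k λ i v b p av → case Any.any? (_∈? X) (vertices p) of λ where
      (no ¬hit) → X-separates i v b p λ z m → All.lookup (¬Any⇒All¬ _ ¬hit) m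
      (yes hit) → let z , z∈X , α , β , eq , α-av = splitAtFirst (_∈? X) p hit
                      q , q≡ = without-avoidsButTarget α α-av
                  in T-sep i z z∈X q λ w m → av w (∈-split⁺ˡ α β eq (subst (w ∈_) q≡ m))

    noSepᵇ : NoSmallSeparator E xs B
    noSepᵇ T |T|<k T-sep = noSep T |T|<k λ i v b p av → case Any.any? (_∈? X) (vertices p) of λ where
      (no ¬hit) → X-separates i v b p λ z m → All.lookup (¬Any⇒All¬ _ ¬hit) m
      (yes hit) → let z , z∈X , α , β , eq , β-av = splitAtLast (_∈? X) p hit
                      q , q≡ = without-avoidsButSource β β-av
                      j , xs-j≡z = ∈X⇒ z∈X
                  in T-sep j v b (subst (λ s → EWalk E s v) (sym xs-j≡z) q) λ w m →
                       av w (∈-split⁺ʳ α β eq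
                              (subst (w ∈_) q≡ (subst (w ∈_) (vertices-subst (sym xs-j≡z) q) m)))

  -- Contracting the edge xy merges y into x. As y is not a source, a linkage of the contracted
  -- instance lifts back, and a small separator S of it either avoids x (and separates already) or
  -- yields the separator S ∪ {y}, which is too small or splits the instance.
  module Contraction {N} (IH : MengerUpTo N) {x y : Fin n} {E : List (Edge n)} (|E|≤N : length E ≤ N)
    {k} {a : Fin k → Fin n} (a-inj : Injective _≡_ _≡_ a) {B : Fin n → Set} (B? : Decidable B)
    (noSep : NoSmallSeparator ((x , y) ∷ E) a B) (a≢y : ∀ i → a i ≢ y) where

    Exy : List (Edge n)
    Exy = (x , y) ∷ E

    merge : Fin n → Fin n
    merge v with v Fin.≟ y
    ... | yes _ = x
    ... | no _ = v

    merge-y : merge y ≡ x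
    merge-y with y Fin.≟ y
    ... | yes _ = refl
    ... | no y≢y = ⊥-elim (y≢y refl)

    merge-≢ : ∀ {v} → v ≢ y → merge v ≡ v
    merge-≢ {v} v≢y with v Fin.≟ y
    ... | yes v≡y = ⊥-elim (v≢y v≡y)
    ... | no _ = refl

    merge-x : merge x ≡ x
    merge-x with x Fin.≟ y
    ... | yes _ = refl
    ... | no _ = refl

    merge∈⁻ : ∀ {g T} → merge g ∈ T → (g ≡ y × x ∈ T) ⊎ g ∈ T
    merge∈⁻ {g} {T} m with g Fin.≟ y
    ... | yes g≡y = inj₁ (g≡y , m)
    ... | no _ = inj₂ m

    E/xy : List (Edge n)
    E/xy = map (Product.map merge merge) E

    B/xy : Fin n → Set
    B/xy v = (B v × v ≢ y) ⊎ (v ≡ x × B y)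

    B/xy? : Decidable B/xy
    B/xy? v = (B? v ×-dec ¬? (v Fin.≟ y)) ⊎-dec ((v Fin.≟ x) ×-dec B? y)

    B⇒B/xy : ∀ {v} → B v → B/xy (merge v)
    B⇒B/xy {v} b with v Fin.≟ y
    ... | yes refl = inj₂ (refl , b)
    ... | no v≢y = inj₁ (b , v≢y)

    B/xy⇒B : ∀ {v} → B/xy v → Σ[ g ∈ Fin n ] B g × merge g ≡ v
    B/xy⇒B {v} (inj₁ (b , v≢y)) = v , b , merge-≢ v≢y
    B/xy⇒B (inj₂ (refl , b)) = y , b , merge-y

    merge-step : ∀ {u w} → ReflAdj Exy u w → ReflAdj E/xy (merge u) (merge w)
    merge-step (inj₁ refl) = inj₁ refl
    merge-step (inj₂ (inj₁ (here refl))) = inj₁ (trans merge-x (sym merge-y))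
    merge-step (inj₂ (inj₁ (there m))) = inj₂ (inj₁ (∈-map⁺ _ m))
    merge-step (inj₂ (inj₂ (here refl))) = inj₁ (trans merge-y (sym merge-x))
    merge-step (inj₂ (inj₂ (there m))) = inj₂ (inj₂ (∈-map⁺ _ m))

    project : ∀ {u v} → EWalk Exy u v → EWalk E/xy (merge u) (merge v)
    project = Star.gmap merge merge-step

    bridge : ∀ g₀ g₁ → merge g₀ ≡ merge g₁ →
             Σ[ q ∈ EWalk Exy g₀ g₁ ] (∀ u → u ∈ vertices q → merge u ≡ merge g₀)
    bridge g₀ g₁ eq = cases (g₀ Fin.≟ g₁) (g₀ Fin.≟ y) (g₁ Fin.≟ y)
      where
      cases : Dec (g₀ ≡ g₁) → Dec (g₀ ≡ y) → Dec (g₁ ≡ y) →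
              Σ[ q ∈ EWalk Exy g₀ g₁ ] (∀ u → u ∈ vertices q → merge u ≡ merge g₀)
      cases (yes refl) _ _ = ε , λ { u (here refl) → refl }
      cases (no g₀≢g₁) (yes g₀≡y) (yes g₁≡y) = ⊥-elim (g₀≢g₁ (trans g₀≡y (sym g₁≡y)))
      cases (no _) (yes refl) (no g₁≢y) with trans (sym (merge-≢ g₁≢y)) (trans (sym eq) merge-y)
      ... | refl = inj₂ (inj₂ (here refl)) ◅ ε ,
                   λ { u (here refl) → refl ; u (there (here refl)) → trans merge-x (sym merge-y) }
      cases (no _) (no g₀≢y) (yes refl) with trans (sym (merge-≢ g₀≢y)) (trans eq merge-y)
      ... | refl = inj₂ (inj₁ (here refl)) ◅ ε ,
                   λ { u (here refl) → refl ; u (there (here refl)) → trans merge-y (sym merge-x) }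
      cases (no g₀≢g₁) (no g₀≢y) (no g₁≢y) =
        ⊥-elim (g₀≢g₁ (trans (sym (merge-≢ g₀≢y)) (trans eq (merge-≢ g₁≢y))))

    cross : ∀ {g₀ g₁ s t rest} → ReflAdj Exy s t → merge g₀ ≡ merge s →
            Σ[ q ∈ EWalk Exy t g₁ ] (∀ u → u ∈ vertices q → merge u ∈ rest) →
            Σ[ q ∈ EWalk Exy g₀ g₁ ] (∀ u → u ∈ vertices q → merge u ∈ merge g₀ ∷ rest)
    cross {g₀} {s = s} r eq (q₂ , q₂⊆) with bridge g₀ s eq
    ... | q₁ , q₁⊆ = q₁ ◅◅ r ◅ q₂ , λ u u∈ → case ∈-◅◅⁻ q₁ (r ◅ q₂) u∈ of λ where
      (inj₁ m₁) → here (q₁⊆ u m₁)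
      (inj₂ (here refl)) → here (sym eq)
      (inj₂ (there m₂)) → there (q₂⊆ u m₂)

    lift : ∀ {v w} (p : EWalk E/xy v w) g₀ g₁ → merge g₀ ≡ v → merge g₁ ≡ w →
           Σ[ q ∈ EWalk Exy g₀ g₁ ] (∀ u → u ∈ vertices q → merge u ∈ vertices p)
    lift ε g₀ g₁ refl e₁ = let q , q⊆ = bridge g₀ g₁ (sym e₁) in q , λ u m → here (q⊆ u m)
    lift (inj₁ refl ◅ p) g₀ g₁ e₀ e₁ =
      let q , q⊆ = lift p g₀ g₁ e₀ e₁ in q , λ u m → there (q⊆ u m)
    lift (inj₂ (inj₁ m) ◅ p) g₀ g₁ refl e₁ with ∈-map⁻ _ m
    ... | (s , t) , st∈E , eq =
      cross (inj₂ (inj₁ (there st∈E))) (cong proj₁ eq) (lift p t g₁ (sym (cong proj₂ eq)) e₁)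
    lift (inj₂ (inj₂ m) ◅ p) g₀ g₁ refl e₁ with ∈-map⁻ _ m
    ... | (s , t) , st∈E , eq =
      cross (inj₂ (inj₂ (there st∈E))) (cong proj₂ eq) (lift p s g₁ (sym (cong proj₁ eq)) e₁)

    lift-linkage : Linkage E/xy a B/xy → Linkage Exy a B
    lift-linkage L = record
      { target = λ i → proj₁ (B/xy⇒B (target∈B i)) ; walk = λ i → proj₁ (lifted i)
      ; target∈B = λ i → proj₁ (proj₂ (B/xy⇒B (target∈B i)))
      ; disjoint = λ i j i≢j u m m′ →
          disjoint i j i≢j (merge u) (proj₂ (lifted i) u m) (proj₂ (lifted j) u m′) }
      where
      open Linkage L
      lifted : ∀ i → _
      lifted i = lift (walk i) (a i) _ (merge-≢ (a≢y i)) (proj₂ (proj₂ (B/xy⇒B (target∈B i))))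

    separates-lift : ∀ {S T} → (∀ g → merge g ∈ S → g ∈ T) → Separates E/xy a B/xy S → Separates Exy a B T
    separates-lift S⊆T sep i v b p av = sep i (merge v) (B⇒B/xy b) p/ λ z z∈ z∈S →
      let g , g∈p , z≡ = ∈-map⁻ merge (subst (z ∈_) (trans (vertices-subst (merge-≢ (a≢y i)) (project p))
                                                             (vertices-gmap merge merge-step p)) z∈)
      in av g g∈p (S⊆T g (subst (_∈ _) z≡ z∈S))
      where
      p/ : EWalk E/xy (a i) (merge v)
      p/ = subst (λ s → EWalk E/xy s (merge v)) (merge-≢ (a≢y i)) (project p)

    module _ (S : List (Fin n)) where

      S+y : List (Fin n)
      S+y = deduplicate Fin._≟_ (y ∷ S)

      y∈S+y : y ∈ S+y
      y∈S+y = ∈-deduplicate⁺ Fin._≟_ {xs = y ∷ S} (here refl)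

      S⊆S+y : ∀ {g} → g ∈ S → g ∈ S+y
      S⊆S+y g∈S = ∈-deduplicate⁺ Fin._≟_ {xs = y ∷ S} (there g∈S)

      |S+y|≤ : length S+y ≤ suc (length S)
      |S+y|≤ = length-deduplicate Fin._≟_ (y ∷ S)

      S+y-separates : Separates E/xy a B/xy S → Separates Exy a B S+y
      S+y-separates = separates-lift λ g m →
        [ (λ (g≡y , _) → subst (_∈ S+y) (sym g≡y) y∈S+y) , S⊆S+y ]′ (merge∈⁻ m)

    noSep/xy : ¬ Linkage Exy a B → NoSmallSeparator E/xy a B/xy
    noSep/xy ¬L S |S|<k sep with x ∈? S
    ... | no x∉S = noSep S |S|<k (separates-lift S⊆S sep)
      where
      S⊆S : ∀ g → merge g ∈ S → g ∈ S
      S⊆S g m = [ (λ (_ , x∈S) → ⊥-elim (x∉S x∈S)) , (λ g∈S → g∈S) ]′ (merge∈⁻ m)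
    ... | yes x∈S with length (S+y S) ℕ.<? k
    ...   | yes |S+y|<k = noSep (S+y S) |S+y|<k (S+y-separates S sep)
    ...   | no |S+y|≮k =
      linkage-via-separator (IH E |E|≤N) a-inj B? noSep (S+y S) (deduplicate-! Fin._≟_ (y ∷ S))
        (ℕ.≤-antisym (ℕ.≤-trans (|S+y|≤ S) |S|<k) (ℕ.≮⇒≥ |S+y|≮k)) (S⊆S+y S x∈S) (y∈S+y S)
        (S+y-separates S sep) ¬L

    linkage : ¬ ¬ Linkage Exy a B
    linkage ¬L = IH E/xy (subst (_≤ N) (sym (length-map _ E)) |E|≤N) a a-inj B/xy B/xy?
                    (noSep/xy ¬L) (¬L ∘ lift-linkage)

  linkage-dropping-source-edge : ∀ {x y E k} → MengerFor E → {a : Fin k → Fin n} → Injective _≡_ _≡_ a →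
    {B : Fin n → Set} → Decidable B → NoSmallSeparator ((x , y) ∷ E) a B →
    (∃ λ i → a i ≡ x) → (∃ λ j → a j ≡ y) → ¬ ¬ Linkage ((x , y) ∷ E) a B
  linkage-dropping-source-edge {x} {y} {E} IH {a} a-inj {B} B? noSep (i₀ , a-i₀≡x) (j₀ , a-j₀≡y) ¬L =
    IH a a-inj B B? noSepᴱ (¬L ∘ linkage-map (reflAdj-mono there))
    where
    End : Fin n → Set
    End g = g ≡ x ⊎ g ≡ y

    End? : Decidable End
    End? g = (g Fin.≟ x) ⊎-dec (g Fin.≟ y)

    End⇒source : ∀ {z} → End z → ∃ λ i → a i ≡ z
    End⇒source (inj₁ refl) = i₀ , a-i₀≡x
    End⇒source (inj₂ refl) = j₀ , a-j₀≡y

    open DeleteEdge {E = E} {D = End} (inj₁ refl) (inj₂ refl)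

    noSepᴱ : NoSmallSeparator E a B
    noSepᴱ T |T|<k T-sep = noSep T |T|<k λ i v b p av → case Any.any? End? (vertices p) of λ where
      (no ¬hit) → let q , q≡ = without-avoids p (λ z m → All.lookup (¬Any⇒All¬ _ ¬hit) m)
                  in T-sep i v b q λ w m → av w (subst (w ∈_) q≡ m)
      (yes hit) → let z , end , α , β , eq , β-av = splitAtLast End? p hit
                      q , q≡ = without-avoidsButSource β β-av
                      i₁ , a-i₁≡z = End⇒source end
                  in T-sep i₁ v b (subst (λ s → EWalk E s v) (sym a-i₁≡z) q) λ w m →
                       av w (∈-split⁺ʳ α β eq
                              (subst (w ∈_) q≡ (subst (w ∈_) (vertices-subst (sym a-i₁≡z) q) m)))

  menger-≤ : ∀ N → MengerUpTo N
  menger-≤ N [] _ a a-inj B B? noSep ¬L = ¬L (linkage-[] a a-inj B B? noSep)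
  menger-≤ (suc N) ((x , y) ∷ E) (s≤s |E|≤N) a a-inj B B? noSep
    with Fin.any? (λ i → a i Fin.≟ y) | Fin.any? (λ i → a i Fin.≟ x)
  ... | no y∉a | _ =
    Contraction.linkage (menger-≤ N) |E|≤N a-inj B? noSep (λ i e → y∉a (i , e))
  ... | yes _ | no x∉a = λ ¬L →
    Contraction.linkage (menger-≤ N) |E|≤N a-inj B? (λ S |S|<k → noSep S |S|<k ∘ separates-map reflAdj-swap)
      (λ i e → x∉a (i , e)) (¬L ∘ linkage-map reflAdj-swap)
  ... | yes y∈a | yes x∈a = linkage-dropping-source-edge (menger-≤ N E |E|≤N) a-inj B? noSep x∈a y∈a

  menger : (E : List (Edge n)) → MengerFor E
  menger E = menger-≤ (length E) E ℕ.≤-refl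

-- Counting

injection-escapes : ∀ {A n} (f : Fin A → Fin n) → Injective _≡_ _≡_ f →
                    (S : List (Fin n)) → length S < A → ∃ λ i → f i ∉ S
injection-escapes {A} f f-inj S |S|<A with Fin.any? (λ i → ¬? (f i ∈? S))
... | yes found = found
... | no none = ⊥-elim (ℕ.<⇒≱ |S|<A (Fin.injective⇒≤ position-inj))
  where
  f∈S : ∀ i → f i ∈ S
  f∈S i with f i ∈? S
  ... | yes m = m
  ... | no ¬m = ⊥-elim (none (i , ¬m))
  position-inj : Injective _≡_ _≡_ (index ∘ f∈S)
  position-inj {i} {j} eq =
    f-inj (trans (lookup-index (f∈S i)) (trans (cong (lookup S) eq) (sym (lookup-index (f∈S j)))))

length-filter+filter¬ : ∀ {A : Set} {P : A → Set} (P? : ∀ x → Dec (P x)) (xs : List A) →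
  length (filter P? xs) + length (filter (¬? ∘ P?) xs) ≡ length xs
length-filter+filter¬ P? [] = refl
length-filter+filter¬ P? (x ∷ xs) with P? x
... | yes _ = cong suc (length-filter+filter¬ P? xs)
... | no _ = trans (ℕ.+-suc _ _) (cong suc (length-filter+filter¬ P? xs))

complement-injection : ∀ {A c m} (β : Fin A → Fin m) → Injective _≡_ _≡_ β → m ≡ A + c →
  Σ[ γ ∈ (Fin c → Fin m) ] Injective _≡_ _≡_ γ × (∀ l p → γ l ≢ β p)
complement-injection {A} {c} {m} β β-inj m≡ = γ , γ-inj , γ∉β
  where
  Image : Fin m → Set
  Image z = ∃ λ p → β p ≡ z

  Image? : ∀ z → Dec (Image z)
  Image? z = Fin.any? (λ p → β p Fin.≟ z)

  image coimage : List (Fin m)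
  image = filter Image? (allFin m)
  coimage = filter (¬? ∘ Image?) (allFin m)

  in-image : ∀ j → Image (lookup image j)
  in-image j = proj₂ (∈-filter⁻ Image? {xs = allFin m} (∈-lookup {xs = image} j))

  preimage-inj : Injective _≡_ _≡_ (proj₁ ∘ in-image)
  preimage-inj {i} {j} eq = lookup-injective (Unique.filter⁺ Image? (Unique.allFin⁺ m))
    (trans (sym (proj₂ (in-image i))) (trans (cong β eq) (proj₂ (in-image j))))

  c≤|coimage| : c ≤ length coimage
  c≤|coimage| = ℕ.+-cancelˡ-≤ A c (length coimage)
    (subst (_≤ A + length coimage) (trans (trans (length-filter+filter¬ Image? (allFin m)) (length-tabulate _)) m≡)
      (ℕ.+-monoˡ-≤ (length coimage) (Fin.injective⇒≤ preimage-inj)))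

  γ : Fin c → Fin m
  γ l = lookup coimage (Fin.inject≤ l c≤|coimage|)

  γ-inj : Injective _≡_ _≡_ γ
  γ-inj eq = Fin.inject≤-injective c≤|coimage| c≤|coimage| _ _
    (lookup-injective (Unique.filter⁺ (¬? ∘ Image?) (Unique.allFin⁺ m)) eq)

  γ∉β : ∀ l p → γ l ≢ β p
  γ∉β l p eq = proj₂ (∈-filter⁻ (¬? ∘ Image?) {xs = allFin m} (∈-lookup {xs = coimage} (Fin.inject≤ l c≤|coimage|)))
                     (p , sym eq)

sumᶠ : ∀ {K} → (Fin K → ℕ) → ℕ
sumᶠ {zero} f = 0
sumᶠ {suc K} f = f zero + sumᶠ (f ∘ suc)

sumᶠ-cong : ∀ {K} {f g : Fin K → ℕ} → (∀ p → f p ≡ g p) → sumᶠ f ≡ sumᶠ g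
sumᶠ-cong {zero} h = refl
sumᶠ-cong {suc K} h = cong₂ _+_ (h zero) (sumᶠ-cong (h ∘ suc))

sumᶠ-<-update : ∀ {K} (f g : Fin K → ℕ) (q : Fin K) → g q < f q → (∀ p → p ≢ q → g p ≡ f p) →
                sumᶠ g < sumᶠ f
sumᶠ-<-update {suc K} f g zero lt h = ℕ.+-mono-<-≤ lt (ℕ.≤-reflexive (sumᶠ-cong (λ i → h (suc i) λ ())))
sumᶠ-<-update {suc K} f g (suc q) lt h = ℕ.+-mono-≤-< (ℕ.≤-reflexive (h zero λ ()))
  (sumᶠ-<-update (f ∘ suc) (g ∘ suc) q lt (λ p p≢q → h (suc p) (p≢q ∘ Fin.suc-injective)))

data Consecutive {A : Set} (a c : A) : List A → Set where
  here  : ∀ {xs} → Consecutive a c (a ∷ c ∷ xs)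
  there : ∀ {y xs} → Consecutive a c xs → Consecutive a c (y ∷ xs)

consecutive? : ∀ {n} (a c : Fin n) (xs : List (Fin n)) → Dec (Consecutive a c xs)
consecutive? a c [] = no λ ()
consecutive? a c (x ∷ []) = no λ { (there ()) }
consecutive? a c (x ∷ y ∷ xs) with a Fin.≟ x | c Fin.≟ y | consecutive? a c (y ∷ xs)
... | yes refl | yes refl | _ = yes here
... | _ | _ | yes r = yes (there r)
... | no a≢x | _ | no ¬r = no λ { here → a≢x refl ; (there r) → ¬r r }
... | yes _ | no c≢y | no ¬r = no λ { here → c≢y refl ; (there r) → ¬r r }

consecutive-∈₁ : ∀ {A : Set} {a c : A} {xs} → Consecutive a c xs → a ∈ xs
consecutive-∈₁ here = here refl
consecutive-∈₁ (there r) = there (consecutive-∈₁ r)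

consecutive-∈₂ : ∀ {A : Set} {a c : A} {xs} → Consecutive a c xs → c ∈ xs
consecutive-∈₂ here = there (here refl)
consecutive-∈₂ (there r) = there (consecutive-∈₂ r)

-- The argument for a graph given by an edge list E containing the paths P of a subdivision of
-- K_{3k-1} with branch vertices b, rooted at s₀ = b r.
module Linking {n : ℕ} (E : List (Edge n)) {k′ : ℕ} (s t : Fin (suc k′) → Fin n)
  (s-inj : Injective _≡_ _≡_ s) (t-inj : Injective _≡_ _≡_ t) (s≢t : ∀ i j → s i ≢ t j)
  {m : ℕ} (m≡ : m ≡ (suc k′ + suc k′) + k′) (b : Fin m → Fin n) (b-inj : Injective _≡_ _≡_ b)
  (P : Fin m → Fin m → List (Fin n))
  (P-ends : ∀ i j → i Fin.< j → ∀ l → b l ∈ P i j → l ≡ i ⊎ l ≡ j)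
  (P-disj : ∀ i j i′ j′ → i Fin.< j → i′ Fin.< j′ → ¬ (i ≡ i′ × j ≡ j′) →
            ∀ x → x ∈ P i j → x ∈ P i′ j′ → ∃ λ l → x ≡ b l)
  (P-walk : ∀ i j → i Fin.< j → Σ[ q ∈ EWalk E (b i) (b j) ]
              vertices q ≡ P i j × AllSteps (λ u w → Consecutive u w (P i j)) q)
  (r : Fin m) (b-r≡s₀ : b r ≡ s zero) (root-adj : ∀ i → i ≢ r → ReflAdj E (s zero) (b i))
  (connected : ∀ S → length S < suc k′ + suc k′ → ∀ u v → u ∉ S → v ∉ S →
               Σ[ p ∈ EWalk E u v ] Avoids (_∈ S) p)
  where

  k K : ℕ
  k = suc k′
  K = k + k

  terminal : Fin K → Fin n
  terminal i = [ s , t ]′ (Fin.splitAt k i)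

  sᵢ tᵢ : Fin k → Fin K
  sᵢ i = i ↑ˡ k
  tᵢ i = k ↑ʳ i

  terminal-sᵢ : ∀ i → terminal (sᵢ i) ≡ s i
  terminal-sᵢ i = cong [ s , t ]′ (Fin.splitAt-↑ˡ k i k)

  terminal-tᵢ : ∀ i → terminal (tᵢ i) ≡ t i
  terminal-tᵢ i = cong [ s , t ]′ (Fin.splitAt-↑ʳ k k i)

  terminal-inj : Injective _≡_ _≡_ terminal
  terminal-inj {i} {j} eq with Fin.splitAt k i in eqi | Fin.splitAt k j in eqj
  ... | inj₁ p | inj₁ q =
    trans (sym (Fin.splitAt⁻¹-↑ˡ eqi)) (trans (cong (_↑ˡ k) (s-inj eq)) (Fin.splitAt⁻¹-↑ˡ eqj))
  ... | inj₁ p | inj₂ q = ⊥-elim (s≢t p q eq)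
  ... | inj₂ p | inj₁ q = ⊥-elim (s≢t q p (sym eq))
  ... | inj₂ p | inj₂ q =
    trans (sym (Fin.splitAt⁻¹-↑ʳ eqi)) (trans (cong (k ↑ʳ_) (t-inj eq)) (Fin.splitAt⁻¹-↑ʳ eqj))

  sᵢ≢tᵢ : ∀ i j → sᵢ i ≢ tᵢ j
  sᵢ≢tᵢ i j eq with trans (sym (Fin.splitAt-↑ˡ k i k)) (trans (cong (Fin.splitAt k) eq) (Fin.splitAt-↑ʳ k k j))
  ... | ()

  Branch : Fin n → Set
  Branch v = ∃ λ z → b z ≡ v

  Branch? : ∀ v → Dec (Branch v)
  Branch? v = Fin.any? (λ z → b z Fin.≟ v)

  OnSubdivision : Fin n → Fin n → Set
  OnSubdivision u w =
    u ≡ w ⊎ Σ[ i ∈ Fin m ] Σ[ j ∈ Fin m ] i Fin.< j × (Consecutive u w (P i j) ⊎ Consecutive w u (P i j))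

  OnSubdivision? : ∀ u w → Dec (OnSubdivision u w)
  OnSubdivision? u w = (u Fin.≟ w) ⊎-dec Fin.any? λ i → Fin.any? λ j →
    (i Fin.<? j) ×-dec (consecutive? u w (P i j) ⊎-dec consecutive? w u (P i j))

  onSubdivision-sym : ∀ {u w} → OnSubdivision u w → OnSubdivision w u
  onSubdivision-sym (inj₁ e) = inj₁ (sym e)
  onSubdivision-sym (inj₂ (i , j , i<j , c)) = inj₂ (i , j , i<j , [ inj₂ , inj₁ ]′ c)

  cost : ∀ {u v} → EWalk E u v → ℕ
  cost = stepsOutside OnSubdivision?

  Along : ∀ {u v} → EWalk E u v → Set
  Along = AllSteps OnSubdivision

  along-stays : ∀ lo hi → lo Fin.< hi → ∀ {u v} (τ : EWalk E u v) → u ∈ P lo hi → Along τ →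
                AvoidsButTarget Branch τ → v ∈ P lo hi
  along-stays lo hi lo<hi ε u∈ _ _ = u∈
  along-stays lo hi lo<hi (_◅_ {u} {u′} _ τ) u∈ (on , along) (¬branch , av) =
    along-stays lo hi lo<hi τ (next on) along av
    where
    next : OnSubdivision u u′ → u′ ∈ P lo hi
    next (inj₁ refl) = u∈
    next (inj₂ (i , j , i<j , c)) with (lo Fin.≟ i) ×-dec (hi Fin.≟ j)
    ... | yes (refl , refl) = [ consecutive-∈₂ , consecutive-∈₁ ]′ c
    ... | no ¬same with P-disj lo hi i j lo<hi i<j ¬same u u∈ ([ consecutive-∈₁ , consecutive-∈₂ ]′ c)
    ...   | l , u≡ = ⊥-elim (¬branch (l , sym u≡))

  record Connection (c w : Fin m) : Set where
    field
      lo hi  : Fin m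
      lo<hi  : lo Fin.< hi
      ends   : (lo ≡ c × hi ≡ w) ⊎ (lo ≡ w × hi ≡ c)
      walk   : EWalk E (b c) (b w)
      walk⊆P : ∀ x → x ∈ vertices walk → x ∈ P lo hi
      along  : Along walk

  connection : ∀ c w → c ≢ w → Connection c w
  connection c w c≢w with Fin.<-cmp c w
  ... | tri< c<w _ _ = let q , q≡ , steps = P-walk c w c<w in record
    { lo = c ; hi = w ; lo<hi = c<w ; ends = inj₁ (refl , refl) ; walk = q
    ; walk⊆P = λ x m → subst (x ∈_) q≡ m
    ; along = allSteps-mono (λ con → inj₂ (c , w , c<w , inj₁ con)) q steps }
  ... | tri≈ _ c≡w _ = ⊥-elim (c≢w c≡w)
  ... | tri> _ _ w<c = let q , q≡ , steps = P-walk w c w<c in record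
    { lo = w ; hi = c ; lo<hi = w<c ; ends = inj₂ (refl , refl) ; walk = reverse reflAdj-sym q
    ; walk⊆P = λ x m → subst (x ∈_) q≡ (∈-reverse⁻ reflAdj-sym q m)
    ; along = allSteps-reverse reflAdj-sym onSubdivision-sym q
                (allSteps-mono (λ con → inj₂ (w , c , w<c , inj₁ con)) q steps) }

  module _ {c w : Fin m} (κ : Connection c w) where
    open Connection κ

    connection-branch : ∀ l → b l ∈ P lo hi → l ≡ c ⊎ l ≡ w
    connection-branch l m with ends | P-ends lo hi lo<hi l m
    ... | inj₁ (refl , refl) | e = e
    ... | inj₂ (refl , refl) | e = [ inj₂ , inj₁ ]′ e

    connection-end : c ≡ lo ⊎ c ≡ hi
    connection-end = [ (λ (e , _) → inj₁ (sym e)) , (λ (_ , e) → inj₂ (sym e)) ]′ ends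

    connection-ends⁻ : ∀ z → z ≡ lo ⊎ z ≡ hi → z ≡ c ⊎ z ≡ w
    connection-ends⁻ z z∈ with ends | z∈
    ... | inj₁ (refl , refl) | e = e
    ... | inj₂ (refl , refl) | e = [ inj₂ , inj₁ ]′ e

  -- Connections between four distinct branch vertices lie on distinct subdivision paths, whose
  -- common vertices would be branch vertices, i.e. ends of both.
  connections-disjoint : ∀ {c w c′ w′} (κ : Connection c w) (κ′ : Connection c′ w′) →
    c ≢ c′ → c ≢ w′ → w ≢ c′ → w ≢ w′ →
    ∀ v → v ∈ P (Connection.lo κ) (Connection.hi κ) → v ∉ P (Connection.lo κ′) (Connection.hi κ′)
  connections-disjoint {c} {w} κ κ′ c≢c′ c≢w′ w≢c′ w≢w′ v m m′
    with P-disj (lo κ) (hi κ) (lo κ′) (hi κ′) (lo<hi κ) (lo<hi κ′) distinct v m m′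
    where
    open Connection
    distinct : ¬ (lo κ ≡ lo κ′ × hi κ ≡ hi κ′)
    distinct (e₁ , e₂) = [ c≢c′ , c≢w′ ]′
      (connection-ends⁻ κ′ c ([ (λ e → inj₁ (trans e e₁)) , (λ e → inj₂ (trans e e₂)) ]′ (connection-end κ)))
  ... | l , refl with connection-branch κ l m | connection-branch κ′ l m′
  ... | inj₁ e | inj₁ e′ = c≢c′ (trans (sym e) e′)
  ... | inj₁ e | inj₂ e′ = c≢w′ (trans (sym e) e′)
  ... | inj₂ e | inj₁ e′ = w≢c′ (trans (sym e) e′)
  ... | inj₂ e | inj₂ e′ = w≢w′ (trans (sym e) e′)

  record Routing : Set where
    field
      branch   : Fin K → Fin m
      route    : ∀ p → EWalk E (terminal p) (b (branch p))
      internal : ∀ p → AvoidsButTarget Branch (route p)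
      disjoint : Disjoint route

  total-cost : Routing → ℕ
  total-cost ρ = sumᶠ (cost ∘ Routing.route ρ)

  -- A set of fewer than 2k vertices misses a terminal and one of the 3k - 1 branch vertices.
  terminals-branches-noSep : NoSmallSeparator E terminal Branch
  terminals-branches-noSep S |S|<K sep with injection-escapes terminal terminal-inj S |S|<K
                                           | injection-escapes b b-inj S (ℕ.<-≤-trans |S|<K |K|≤m)
    where
    |K|≤m : K ≤ m
    |K|≤m = subst (K ≤_) (sym m≡) (ℕ.m≤m+n K k′)
  ... | i , i∉S | z , z∉S = let p , avoids = connected S |S|<K (terminal i) (b z) i∉S z∉S
                            in sep i (b z) (z , refl) p avoids

  routing : Linkage E terminal Branch → Routing
  routing L = record
    { branch = λ p → proj₁ (first p) ; route = λ p → proj₁ (proj₂ (first p))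
    ; internal = λ p → proj₁ (proj₂ (proj₂ (first p)))
    ; disjoint = λ i j i≢j x m m′ → disjoint i j i≢j x (proj₂ (proj₂ (proj₂ (first i))) x m)
                                                         (proj₂ (proj₂ (proj₂ (first j))) x m′) }
    where
    open Linkage L
    first : ∀ p → Σ[ z ∈ Fin m ] Σ[ w ∈ EWalk E (terminal p) (b z) ]
                    AvoidsButTarget Branch w × (∀ x → x ∈ vertices w → x ∈ vertices (walk p))
    first p with splitAtFirst Branch? (walk p) (lose (target∈ (walk p)) (target∈B p))
    ... | _ , (z , refl) , α , β , eq , av = z , α , av , λ x → ∈-split⁺ˡ α β eq

  module Replace (ρ : Routing) (q : Fin K) {z : Fin m} (N : EWalk E (terminal q) (b z))
    (N-internal : AvoidsButTarget Branch N)
    (N-disjoint : ∀ p → p ≢ q → ∀ x → x ∈ vertices N → x ∉ vertices (Routing.route ρ p)) where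
    open Routing ρ

    Slot : Fin K → Set
    Slot p = Σ[ z ∈ Fin m ] Σ[ w ∈ EWalk E (terminal p) (b z) ] AvoidsButTarget Branch w

    slot : ∀ p → Dec (p ≡ q) → Slot p
    slot p (yes refl) = z , N , N-internal
    slot p (no _) = branch p , route p , internal p

    route′ : ∀ p → EWalk E (terminal p) (b (proj₁ (slot p (p Fin.≟ q))))
    route′ p = proj₁ (proj₂ (slot p (p Fin.≟ q)))

    route′-vertices : ∀ p x → x ∈ vertices (route′ p) →
                      (p ≡ q × x ∈ vertices N) ⊎ (p ≢ q × x ∈ vertices (route p))
    route′-vertices p x m with p Fin.≟ q
    ... | yes refl = inj₁ (refl , m)
    ... | no p≢q = inj₂ (p≢q , m)

    replaced : Routing
    replaced = record
      { branch = λ p → proj₁ (slot p (p Fin.≟ q)) ; route = route′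
      ; internal = λ p → proj₂ (proj₂ (slot p (p Fin.≟ q)))
      ; disjoint = λ i j i≢j x m m′ → case route′-vertices i x m , route′-vertices j x m′ of λ where
          (inj₁ (refl , mN) , inj₁ (refl , _)) → i≢j refl
          (inj₁ (refl , mN) , inj₂ (j≢q , mj)) → N-disjoint j j≢q x mN mj
          (inj₂ (i≢q , mi) , inj₁ (refl , mN)) → N-disjoint i i≢q x mN mi
          (inj₂ (_ , mi) , inj₂ (_ , mj)) → disjoint i j i≢j x mi mj }

    cheaper : cost N < cost (route q) → total-cost replaced < total-cost ρ
    cheaper N<q = sumᶠ-<-update (cost ∘ route) (cost ∘ route′) q cost-q cost-other
      where
      cost-q : cost (route′ q) < cost (route q)
      cost-q with q Fin.≟ q
      ... | yes refl = N<q
      ... | no q≢q = ⊥-elim (q≢q refl)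
      cost-other : ∀ p → p ≢ q → cost (route′ p) ≡ cost (route p)
      cost-other p p≢q with p Fin.≟ q
      ... | yes p≡q = ⊥-elim (p≢q p≡q)
      ... | no _ = refl

  OnRoute : Routing → Fin n → Set
  OnRoute ρ v = ∃ λ p → v ∈ vertices (Routing.route ρ p)

  OnRoute? : ∀ ρ v → Dec (OnRoute ρ v)
  OnRoute? ρ v = Fin.any? (λ p → v ∈? vertices (Routing.route ρ p))

  cost-prefix : ∀ {u v w} (α : EWalk E u v) (β : EWalk E v w) → cost α ≤ cost (α ◅◅ β)
  cost-prefix α β =
    subst (cost α ≤_) (sym (stepsOutside-◅◅ OnSubdivision? α β)) (ℕ.m≤m+n (cost α) (cost β))

  Minimal : Routing → Set
  Minimal ρ = ∀ ρ′ → total-cost ρ′ < total-cost ρ → ⊥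

  module _ (ρ : Routing) where
    open Routing ρ

    approach-disjoint : ∀ {c x} (α : EWalk E (b c) x) → AvoidsButTarget (OnRoute ρ) α →
      ∀ p q → x ∈ vertices (route q) → p ≢ q → ∀ v → v ∈ vertices (route p) → v ∉ vertices α
    approach-disjoint α av p q x∈q p≢q v v∈p v∈α = disjoint p q p≢q v v∈p
      (subst (_∈ vertices (route q)) (sym (avoidsButTarget-hit α av v∈α (p , v∈p))) x∈q)

    -- A cost-free rest τ of a route passes no branch vertex, so it stays on the connection's path and
    -- ends at one of its ends.
    rest-leaves-subdivision : Injective _≡_ _≡_ branch →
      ∀ {c w} (κ : Connection c w) → (∀ p → c ≢ branch p) → ∀ p₀ → w ≡ branch p₀ →
      ∀ {x} q → q ≢ p₀ → x ∈ P (Connection.lo κ) (Connection.hi κ) →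
      (A : EWalk E (terminal q) x) (τ : EWalk E x (b (branch q))) → route q ≡ A ◅◅ τ → cost τ ≢ 0
    rest-leaves-subdivision branch-inj κ c-unused p₀ w≡ q q≢p₀ x∈P A τ route≡ τ-free =
      [ (λ e → c-unused q (sym e)) , (λ e → q≢p₀ (branch-inj (trans e w≡))) ]′
        (connection-branch κ (branch q) (along-stays lo hi lo<hi τ x∈P
          (stepsOutside≡0⇒allSteps OnSubdivision? τ τ-free)
          (avoidsButTarget-◅◅ʳ A τ (subst (AvoidsButTarget Branch) route≡ (internal q)))))
      where open Connection κ

    -- Diverting route q at x backwards along α, which is free of cost, and cutting at the first branch
    -- vertex saves the cost of the rest τ.
    divert : ∀ {q c x} (A : EWalk E (terminal q) x) (τ : EWalk E x (b (branch q))) → route q ≡ A ◅◅ τ →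
      cost τ ≢ 0 → (α : EWalk E (b c) x) → Along α → AvoidsButTarget (OnRoute ρ) α →
      Σ[ ρ′ ∈ Routing ] total-cost ρ′ < total-cost ρ
    divert {q} {c} {x} A τ route≡ τ-costly α α-along α-av
      with splitAtFirst Branch? (A ◅◅ reverse reflAdj-sym α)
                          (lose (target∈ (A ◅◅ reverse reflAdj-sym α)) (c , refl))
    ... | _ , (z , refl) , N , rest , N≡ , N-internal =
      Replace.replaced ρ q N N-internal N-disjoint , Replace.cheaper ρ q N N-internal N-disjoint N<q
      where
      α⁻¹ : EWalk E x (b c)
      α⁻¹ = reverse reflAdj-sym α

      N-disjoint : ∀ p → p ≢ q → ∀ v → v ∈ vertices N → v ∉ vertices (route p)
      N-disjoint p p≢q v v∈N v∈p = [
        (λ v∈A → disjoint q p (p≢q ∘ sym) v (∈-split⁺ˡ A τ route≡ v∈A) v∈p) ,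
        (λ v∈α → approach-disjoint α α-av p q (∈-split⁺ʳ A τ route≡ (source∈ τ)) p≢q v v∈p
                   (∈-reverse⁻ reflAdj-sym α v∈α)) ]′
        (∈-◅◅⁻ A α⁻¹ (∈-split⁺ˡ N rest N≡ v∈N))

      N<q : cost N < cost (route q)
      N<q = begin-strict
        cost N                 ≤⟨ cost-prefix N rest ⟩
        cost (N ◅◅ rest)       ≡⟨ cong cost (sym N≡) ⟩
        cost (A ◅◅ α⁻¹)        ≡⟨ stepsOutside-◅◅ OnSubdivision? A α⁻¹ ⟩
        cost A + cost α⁻¹      ≡⟨ cong (cost A +_) (allSteps⇒stepsOutside≡0 OnSubdivision? α⁻¹
                                    (allSteps-reverse reflAdj-sym onSubdivision-sym α α-along)) ⟩
        cost A + 0             <⟨ ℕ.+-monoʳ-< (cost A) (ℕ.n≢0⇒n>0 τ-costly) ⟩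
        cost A + cost τ        ≡⟨ sym (stepsOutside-◅◅ OnSubdivision? A τ) ⟩
        cost (A ◅◅ τ)          ≡⟨ cong cost (sym route≡) ⟩
        cost (route q)         ∎
        where open ℕ.≤-Reasoning

    -- Otherwise the route met first could be diverted to c at a lower cost.
    first-meeting-route : Minimal ρ → Injective _≡_ _≡_ branch →
      ∀ {c w} (κ : Connection c w) → (∀ p → c ≢ branch p) → ∀ p₀ → w ≡ branch p₀ →
      ∀ {x} q → x ∈ vertices (route q) → (α : EWalk E (b c) x) →
      (∀ v → v ∈ vertices α → v ∈ P (Connection.lo κ) (Connection.hi κ)) → Along α →
      AvoidsButTarget (OnRoute ρ) α → q ≡ p₀
    first-meeting-route minimal branch-inj κ c-unused p₀ w≡ q x∈q α α⊆P α-along α-av with q Fin.≟ p₀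
    ... | yes q≡p₀ = q≡p₀
    ... | no q≢p₀ =
      let A , τ , route≡ = splitAtVertex (route q) x∈q
          τ-costly = rest-leaves-subdivision branch-inj κ c-unused p₀ w≡ q q≢p₀
                       (α⊆P _ (target∈ α)) A τ route≡
      in ⊥-elim (uncurry minimal (divert A τ route≡ τ-costly α α-along α-av))

  pairTerminal : Fin k′ → Bool → Fin K
  pairTerminal l true = sᵢ (suc l)
  pairTerminal l false = tᵢ (suc l)

  pairTerminal-≢ : ∀ l l′ σ σ′ → l ≢ l′ → pairTerminal l σ ≢ pairTerminal l′ σ′
  pairTerminal-≢ l l′ true true l≢l′ eq = l≢l′ (Fin.suc-injective (Fin.↑ˡ-injective k _ _ eq))
  pairTerminal-≢ l l′ true false l≢l′ eq = sᵢ≢tᵢ _ _ eq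
  pairTerminal-≢ l l′ false true l≢l′ eq = sᵢ≢tᵢ _ _ (sym eq)
  pairTerminal-≢ l l′ false false l≢l′ eq = l≢l′ (Fin.suc-injective (Fin.↑ʳ-injective k _ _ eq))

  Linked : Set
  Linked = Σ[ L ∈ (∀ i → EWalk E (s i) (t i)) ] Disjoint L

  -- The pair s₀, t₀ is linked through the root edge from s₀ = b r to b (branch t₀); the pair
  -- s_{l+1}, t_{l+1} through the unused branch vertex γ l, reached from both routes by the walks α l σ.
  module Assemble (ρ : Routing) (branch-inj : Injective _≡_ _≡_ (Routing.branch ρ))
    (γ : Fin k′ → Fin m) (x : Fin k′ → Bool → Fin n) (α : ∀ l σ → EWalk E (b (γ l)) (x l σ))
    (x∈route : ∀ l σ → x l σ ∈ vertices (Routing.route ρ (pairTerminal l σ)))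
    (route-α-disjoint : ∀ p l σ → p ≢ pairTerminal l σ →
                        ∀ v → v ∈ vertices (Routing.route ρ p) → v ∉ vertices (α l σ))
    (α-disjoint : ∀ l l′ σ σ′ → l ≢ l′ → ∀ v → v ∈ vertices (α l σ) → v ∉ vertices (α l′ σ′)) where
    open Routing ρ

    toMeeting : ∀ l σ → EWalk E (terminal (pairTerminal l σ)) (x l σ)
    toMeeting l σ = proj₁ (splitAtVertex (route (pairTerminal l σ)) (x∈route l σ))

    toMeeting⊆ : ∀ l σ v → v ∈ vertices (toMeeting l σ) → v ∈ vertices (route (pairTerminal l σ))
    toMeeting⊆ l σ v with splitAtVertex (route (pairTerminal l σ)) (x∈route l σ)
    ... | A , τ , eq = ∈-split⁺ˡ A τ eq

    branch-s₀ : branch (sᵢ zero) ≡ r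
    branch-s₀ = sym (b-inj (trans b-r≡terminal (avoidsButTarget-hit (route (sᵢ zero)) (internal (sᵢ zero))
                                                   (source∈ (route (sᵢ zero))) (r , b-r≡terminal))))
      where
      b-r≡terminal : b r ≡ terminal (sᵢ zero)
      b-r≡terminal = trans b-r≡s₀ (sym (terminal-sᵢ zero))

    branch-t₀≢r : branch (tᵢ zero) ≢ r
    branch-t₀≢r eq = sᵢ≢tᵢ zero zero (branch-inj (trans branch-s₀ (sym eq)))

    castWalk : ∀ {u u′ v v′} → u ≡ u′ → v ≡ v′ → EWalk E u v → EWalk E u′ v′
    castWalk refl refl p = p

    vertices-castWalk : ∀ {u u′ v v′} (e : u ≡ u′) (e′ : v ≡ v′) (p : EWalk E u v) →
                        vertices (castWalk e e′ p) ≡ vertices p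
    vertices-castWalk refl refl p = refl

    link₀ : EWalk E (s zero) (terminal (tᵢ zero))
    link₀ = root-adj (branch (tᵢ zero)) branch-t₀≢r ◅ reverse reflAdj-sym (route (tᵢ zero))

    link₊ : ∀ l → EWalk E (terminal (sᵢ (suc l))) (terminal (tᵢ (suc l)))
    link₊ l = toMeeting l true ◅◅ reverse reflAdj-sym (α l true) ◅◅
              α l false ◅◅ reverse reflAdj-sym (toMeeting l false)

    link : ∀ i → EWalk E (s i) (t i)
    link zero = castWalk refl (terminal-tᵢ zero) link₀
    link (suc l) = castWalk (terminal-sᵢ (suc l)) (terminal-tᵢ (suc l)) (link₊ l)

    OnBridge : Fin k → Fin n → Set
    OnBridge zero v = ⊥
    OnBridge (suc l) v = v ∈ vertices (α l true) ⊎ v ∈ vertices (α l false)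

    Uses : Fin k → Fin n → Set
    Uses i v = v ∈ vertices (route (sᵢ i)) ⊎ v ∈ vertices (route (tᵢ i)) ⊎ OnBridge i v

    uses-link : ∀ i v → v ∈ vertices (link i) → Uses i v
    uses-link zero v m with subst (v ∈_) (vertices-castWalk refl (terminal-tᵢ zero) link₀) m
    ... | here refl =
      inj₁ (subst (_∈ vertices (route (sᵢ zero))) (terminal-sᵢ zero) (source∈ (route (sᵢ zero))))
    ... | there m′ = inj₂ (inj₁ (∈-reverse⁻ reflAdj-sym (route (tᵢ zero)) m′))
    uses-link (suc l) v m
      with ∈-◅◅⁻ (toMeeting l true) _
             (subst (v ∈_) (vertices-castWalk (terminal-sᵢ (suc l)) (terminal-tᵢ (suc l)) (link₊ l)) m)
    ... | inj₁ m₁ = inj₁ (toMeeting⊆ l true v m₁)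
    ... | inj₂ m₂ with ∈-◅◅⁻ (reverse reflAdj-sym (α l true)) _ m₂
    ...   | inj₁ m₃ = inj₂ (inj₂ (inj₁ (∈-reverse⁻ reflAdj-sym (α l true) m₃)))
    ...   | inj₂ m₄ with ∈-◅◅⁻ (α l false) _ m₄
    ...     | inj₁ m₅ = inj₂ (inj₂ (inj₂ m₅))
    ...     | inj₂ m₆ = inj₂ (inj₁ (toMeeting⊆ l false v (∈-reverse⁻ reflAdj-sym (toMeeting l false) m₆)))

    OfPair : Fin k → Fin K → Set
    OfPair i p = p ≡ sᵢ i ⊎ p ≡ tᵢ i

    ofPair-≢ : ∀ i j → i ≢ j → ∀ {p p′} → OfPair i p → OfPair j p′ → p ≢ p′
    ofPair-≢ i j i≢j (inj₁ refl) (inj₁ refl) eq = i≢j (Fin.↑ˡ-injective k _ _ eq)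
    ofPair-≢ i j i≢j (inj₁ refl) (inj₂ refl) eq = sᵢ≢tᵢ _ _ eq
    ofPair-≢ i j i≢j (inj₂ refl) (inj₁ refl) eq = sᵢ≢tᵢ _ _ (sym eq)
    ofPair-≢ i j i≢j (inj₂ refl) (inj₂ refl) eq = i≢j (Fin.↑ʳ-injective k _ _ eq)

    route-bridge-disjoint : ∀ i j → i ≢ j → ∀ {p} → OfPair i p →
                            ∀ v → v ∈ vertices (route p) → ¬ OnBridge j v
    route-bridge-disjoint i (suc l) i≢j p∈i v v∈p (inj₁ v∈α) =
      route-α-disjoint _ l true (ofPair-≢ i (suc l) i≢j p∈i (inj₁ refl)) v v∈p v∈α
    route-bridge-disjoint i (suc l) i≢j p∈i v v∈p (inj₂ v∈α) =
      route-α-disjoint _ l false (ofPair-≢ i (suc l) i≢j p∈i (inj₂ refl)) v v∈p v∈α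

    bridges-disjoint : ∀ i j → i ≢ j → ∀ v → OnBridge i v → ¬ OnBridge j v
    bridges-disjoint (suc l) (suc l′) i≢j v v∈ v∈′ =
      α-disjoint l l′ (side v∈) (side v∈′) (i≢j ∘ cong suc) v (onSide v∈) (onSide v∈′)
      where
      side : ∀ {l} → OnBridge (suc l) v → Bool
      side (inj₁ _) = true
      side (inj₂ _) = false
      onSide : ∀ {l} (o : OnBridge (suc l) v) → v ∈ vertices (α l (side o))
      onSide (inj₁ m) = m
      onSide (inj₂ m) = m

    routes-disjoint : ∀ i j → i ≢ j → ∀ {p p′} → OfPair i p → OfPair j p′ →
                      ∀ v → v ∈ vertices (route p) → v ∉ vertices (route p′)
    routes-disjoint i j i≢j p∈i p′∈j = disjoint _ _ (ofPair-≢ i j i≢j p∈i p′∈j)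

    uses-disjoint : ∀ i j → i ≢ j → ∀ v → Uses i v → ¬ Uses j v
    uses-disjoint i j i≢j v (inj₁ a) (inj₁ c) = routes-disjoint i j i≢j (inj₁ refl) (inj₁ refl) v a c
    uses-disjoint i j i≢j v (inj₁ a) (inj₂ (inj₁ c)) = routes-disjoint i j i≢j (inj₁ refl) (inj₂ refl) v a c
    uses-disjoint i j i≢j v (inj₂ (inj₁ a)) (inj₁ c) = routes-disjoint i j i≢j (inj₂ refl) (inj₁ refl) v a c
    uses-disjoint i j i≢j v (inj₂ (inj₁ a)) (inj₂ (inj₁ c)) = routes-disjoint i j i≢j (inj₂ refl) (inj₂ refl) v a c
    uses-disjoint i j i≢j v (inj₁ a) (inj₂ (inj₂ c)) = route-bridge-disjoint i j i≢j (inj₁ refl) v a c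
    uses-disjoint i j i≢j v (inj₂ (inj₁ a)) (inj₂ (inj₂ c)) = route-bridge-disjoint i j i≢j (inj₂ refl) v a c
    uses-disjoint i j i≢j v (inj₂ (inj₂ a)) (inj₁ c) = route-bridge-disjoint j i (i≢j ∘ sym) (inj₁ refl) v c a
    uses-disjoint i j i≢j v (inj₂ (inj₂ a)) (inj₂ (inj₁ c)) = route-bridge-disjoint j i (i≢j ∘ sym) (inj₂ refl) v c a
    uses-disjoint i j i≢j v (inj₂ (inj₂ a)) (inj₂ (inj₂ c)) = bridges-disjoint i j i≢j v a c

    linked : Linked
    linked = link , λ i j i≢j v m m′ → uses-disjoint i j i≢j v (uses-link i v m) (uses-link j v m′)

  module _ (ρ : Routing) (minimal : Minimal ρ) where
    open Routing ρ

    branch-inj : Injective _≡_ _≡_ branch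
    branch-inj {p} {q} eq with p Fin.≟ q
    ... | yes p≡q = p≡q
    ... | no p≢q = ⊥-elim (disjoint p q p≢q (b (branch p)) (target∈ (route p))
                     (subst (λ z → b z ∈ vertices (route q)) (sym eq) (target∈ (route q))))

    unused : Fin k′ → Fin m
    unused = proj₁ (complement-injection branch branch-inj m≡)

    unused-inj : Injective _≡_ _≡_ unused
    unused-inj = proj₁ (proj₂ (complement-injection branch branch-inj m≡))

    unused≢branch : ∀ l p → unused l ≢ branch p
    unused≢branch = proj₂ (proj₂ (complement-injection branch branch-inj m≡))

    record Approach (l : Fin k′) (σ : Bool) : Set where
      field
        κ        : Connection (unused l) (branch (pairTerminal l σ))
        x        : Fin n
        q        : Fin K
        x∈q      : x ∈ vertices (route q)
        α        : EWalk E (b (unused l)) x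
        α⊆P      : ∀ v → v ∈ vertices α → v ∈ P (Connection.lo κ) (Connection.hi κ)
        α-along  : Along α
        α-avoids : AvoidsButTarget (OnRoute ρ) α

    approach-along : ∀ l σ → Connection (unused l) (branch (pairTerminal l σ)) → Approach l σ
    approach-along l σ κ =
      let x , (q , x∈q) , α , β , eq , α-avoids = splitAtFirst (OnRoute? ρ) walk (lose (target∈ walk) end∈route)
      in record { κ = κ ; x = x ; q = q ; x∈q = x∈q ; α = α ; α⊆P = λ v m → walk⊆P v (∈-split⁺ˡ α β eq m)
                ; α-along = allSteps-◅◅ˡ α β (subst Along eq along) ; α-avoids = α-avoids }
      where
      open Connection κ
      end∈route : OnRoute ρ (b (branch (pairTerminal l σ)))
      end∈route = pairTerminal l σ , target∈ (route (pairTerminal l σ))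

    approach : ∀ l σ → Approach l σ
    approach l σ = approach-along l σ (connection _ _ (unused≢branch l (pairTerminal l σ)))

    module Aₗ (l : Fin k′) (σ : Bool) = Approach (approach l σ)

    approach-own : ∀ l σ → Aₗ.q l σ ≡ pairTerminal l σ
    approach-own l σ = first-meeting-route ρ minimal branch-inj κ (unused≢branch l) (pairTerminal l σ) refl
                         q x∈q α α⊆P α-along α-avoids
      where open Aₗ l σ

    minimal-linked : Linked
    minimal-linked = Assemble.linked ρ branch-inj unused Aₗ.x Aₗ.α x∈own route-α-disjoint α-disjoint
      where
      x∈own : ∀ l σ → Aₗ.x l σ ∈ vertices (route (pairTerminal l σ))
      x∈own l σ = subst (λ p → Aₗ.x l σ ∈ vertices (route p)) (approach-own l σ) (Aₗ.x∈q l σ)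

      route-α-disjoint : ∀ p l σ → p ≢ pairTerminal l σ → ∀ v → v ∈ vertices (route p) → v ∉ vertices (Aₗ.α l σ)
      route-α-disjoint p l σ = approach-disjoint ρ (Aₗ.α l σ) (Aₗ.α-avoids l σ) p _ (x∈own l σ)

      α-disjoint : ∀ l l′ σ σ′ → l ≢ l′ → ∀ v → v ∈ vertices (Aₗ.α l σ) → v ∉ vertices (Aₗ.α l′ σ′)
      α-disjoint l l′ σ σ′ l≢l′ v m m′ = connections-disjoint (Aₗ.κ l σ) (Aₗ.κ l′ σ′)
        (l≢l′ ∘ unused-inj) (unused≢branch l _) (unused≢branch l′ _ ∘ sym) (pairTerminal-≢ l l′ σ σ′ l≢l′ ∘ branch-inj)
        v (Aₗ.α⊆P l σ v m) (Aₗ.α⊆P l′ σ′ v m′)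

  linking : ¬ ¬ Linked
  linking ¬linked = menger E terminal terminal-inj Branch Branch? terminals-branches-noSep
    λ L → descend (suc (total-cost (routing L))) (routing L) ℕ.≤-refl
    where
    descend : ∀ c (ρ : Routing) → total-cost ρ < c → ⊥
    descend (suc c) ρ (s≤s ρ≤c) =
      ¬linked (minimal-linked ρ λ ρ′ ρ′<ρ → descend c ρ′ (ℕ.<-≤-trans ρ′<ρ ρ≤c))

-- Deciding linkedness

∈-concatMap⁺ : ∀ {A B : Set} {f : A → List B} {a as y} → a ∈ as → y ∈ f a → y ∈ concatMap f as
∈-concatMap⁺ {f = f} a∈ y∈ = ∈-concat⁺′ y∈ (∈-map⁺ f a∈)

lists≤ : ∀ {n} → ℕ → List (List (Fin n))
lists≤ zero = [] ∷ []
lists≤ {n} (suc d) = [] ∷ concatMap (λ x → map (x ∷_) (lists≤ d)) (allFin n)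

lists≤-complete : ∀ {n} d (xs : List (Fin n)) → length xs ≤ d → xs ∈ lists≤ d
lists≤-complete zero [] _ = here refl
lists≤-complete (suc d) [] _ = here refl
lists≤-complete (suc d) (x ∷ xs) (s≤s |xs|≤d) =
  there (∈-concatMap⁺ (∈-allFin x) (∈-map⁺ (x ∷_) (lists≤-complete d xs |xs|≤d)))

vectors : ∀ {A : Set} → List A → (k : ℕ) → List (Vec A k)
vectors cs zero = [] ∷ []
vectors cs (suc k) = concatMap (λ c → map (c ∷_) (vectors cs k)) cs

vectors-complete : ∀ {A : Set} (cs : List A) k (v : Vec A k) → (∀ i → Vec.lookup v i ∈ cs) → v ∈ vectors cs k
vectors-complete cs zero [] _ = here refl
vectors-complete cs (suc k) (c ∷ v) v⊆cs =
  ∈-concatMap⁺ (v⊆cs zero) (∈-map⁺ (c ∷_) (vectors-complete cs k v (λ i → v⊆cs (suc i))))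

module _ {n : ℕ} (G : Graph n) {k} (s t : Fin k → Fin n) where

  DisjointPaths : (Fin k → List (Fin n)) → Set
  DisjointPaths L = (∀ i → IsPath G (s i) (t i) (L i)) × (∀ i j → i ≢ j → ∀ x → x ∈ L i → x ∉ L j)

  disjointPaths-cong : ∀ {L L′} → (∀ i → L i ≡ L′ i) → DisjointPaths L → DisjointPaths L′
  disjointPaths-cong L≡L′ (paths , disjoint) =
    (λ i → subst (IsPath G (s i) (t i)) (L≡L′ i) (paths i)) ,
    λ i j i≢j x m m′ →
      disjoint i j i≢j x (subst (x ∈_) (sym (L≡L′ i)) m) (subst (x ∈_) (sym (L≡L′ j)) m′)

module _ {n : ℕ} (G : Graph n) (Adj? : ∀ u v → Dec (Graph.Adj G u v)) where
  open Graph G using (Adj)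
  open import Data.List.Relation.Unary.Unique.DecPropositional (Fin._≟_ {n}) using (unique?)

  walk? : ∀ u v xs → Dec (Walk G u v xs)
  walk? u v [] = no λ ()
  walk? u v (x ∷ []) with u Fin.≟ x | v Fin.≟ x
  ... | yes refl | yes refl = yes here
  ... | no u≢x | _ = no λ { here → u≢x refl }
  ... | yes refl | no v≢x = no λ { here → v≢x refl }
  walk? u v (x ∷ y ∷ xs) with u Fin.≟ x | Adj? x y | walk? y v (y ∷ xs)
  ... | yes refl | yes adj | yes w = yes (step adj w)
  ... | no u≢x | _ | _ = no λ { (step _ _) → u≢x refl }
  ... | yes refl | no ¬adj | _ = no λ { (step adj w) → ¬adj (second adj w) }
    where
    second : ∀ {w′ zs} → Adj u w′ → Walk G w′ v (y ∷ zs) → Adj u y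
    second adj here = adj
    second adj (step _ _) = adj
  ... | yes refl | yes _ | no ¬w = no λ { (step _ w) → ¬w (restart w) }
    where
    restart : ∀ {w′} → Walk G w′ v (y ∷ xs) → Walk G y v (y ∷ xs)
    restart here = here
    restart (step adj w) = step adj w

  path? : ∀ u v xs → Dec (IsPath G u v xs)
  path? u v xs = walk? u v xs ×-dec unique? xs

  module _ {k} (s t : Fin k → Fin n) where

    disjointPaths? : ∀ L → Dec (DisjointPaths G s t L)
    disjointPaths? L = Fin.all? (λ i → path? (s i) (t i) (L i)) ×-dec
                       Fin.all? (λ i → Fin.all? λ j → ¬? (i Fin.≟ j) →-dec disjoint? (L i) (L j))
      where
      disjoint? : ∀ xs ys → Dec (∀ x → x ∈ xs → x ∉ ys)
      disjoint? xs ys = map′ (λ all x m → All.lookup all m) (λ h → All.tabulate (λ {x} m → h x m))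
                             (All.all? (λ x → ¬? (x ∈? ys)) xs)

    -- A path has no repeated vertex, so the candidates are the k-tuples of lists of length at most n.
    linkage? : Dec (Σ (Fin k → List (Fin n)) (DisjointPaths G s t))
    linkage? with Any.any? (disjointPaths? ∘ Vec.lookup) (vectors (lists≤ n) k)
    ... | yes found = let v , _ , paths = find found in yes (Vec.lookup v , paths)
    ... | no none = no λ (L , paths) → none (lose
          (vectors-complete (lists≤ n) k (Vec.tabulate L) λ i →
            lists≤-complete n _ (subst (λ xs → length xs ≤ n) (sym (Vec.lookup∘tabulate L i))
              (Fin.injective⇒≤ (lookup-injective (proj₂ (proj₁ paths i))))))
          (disjointPaths-cong G s t (λ i → sym (Vec.lookup∘tabulate L i)) paths))

-- The finite skeleton of G

module _ {n : ℕ} where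

  toSubset : List (Fin n) → Subset n
  toSubset [] = Subset.⊥
  toSubset (x ∷ S) = ⁅ x ⁆ ∪ toSubset S

  ∈-toSubset⁺ : ∀ {x} S → x ∈ S → x Subset.∈ toSubset S
  ∈-toSubset⁺ (y ∷ S) (here refl) = Subset.x∈p∪q⁺ (inj₁ (Subset.x∈⁅x⁆ y))
  ∈-toSubset⁺ (y ∷ S) (there m) = Subset.x∈p∪q⁺ (inj₂ (∈-toSubset⁺ S m))

  ∈-toSubset⁻ : ∀ {x} S → x Subset.∈ toSubset S → x ∈ S
  ∈-toSubset⁻ [] m = ⊥-elim (Subset.∉⊥ m)
  ∈-toSubset⁻ (y ∷ S) m with Subset.x∈p∪q⁻ ⁅ y ⁆ (toSubset S) m
  ... | inj₁ m₁ = here (Subset.x∈⁅y⁆⇒x≡y y m₁)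
  ... | inj₂ m₂ = there (∈-toSubset⁻ S m₂)

∣⁅x⁆∪p∣≤ : ∀ {n} (x : Fin n) (p : Subset n) → ∣ ⁅ x ⁆ ∪ p ∣ ≤ suc ∣ p ∣
∣⁅x⁆∪p∣≤ zero (inside ∷ p) =
  s≤s (ℕ.≤-trans (ℕ.≤-reflexive (cong ∣_∣ (Subset.∪-identityˡ p))) (ℕ.n≤1+n _))
∣⁅x⁆∪p∣≤ zero (outside ∷ p) = s≤s (ℕ.≤-reflexive (cong ∣_∣ (Subset.∪-identityˡ p)))
∣⁅x⁆∪p∣≤ (suc x) (inside ∷ p) = s≤s (∣⁅x⁆∪p∣≤ x p)
∣⁅x⁆∪p∣≤ (suc x) (outside ∷ p) = ∣⁅x⁆∪p∣≤ x p

∣toSubset∣≤length : ∀ {n} (S : List (Fin n)) → ∣ toSubset S ∣ ≤ length S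
∣toSubset∣≤length {n} [] = ℕ.≤-reflexive (Subset.∣⊥∣≡0 n)
∣toSubset∣≤length (x ∷ S) = ℕ.≤-trans (∣⁅x⁆∪p∣≤ x (toSubset S)) (s≤s (∣toSubset∣≤length S))

subsets : ∀ n → List (Subset n)
subsets n = vectors (inside ∷ outside ∷ []) n

∈-subsets : ∀ {n} (p : Subset n) → p ∈ subsets n
∈-subsets p = vectors-complete _ _ p λ i → lemma (Vec.lookup p i)
  where
  lemma : ∀ b → b ∈ inside ∷ outside ∷ []
  lemma true = here refl
  lemma false = there (here refl)

module _ {n : ℕ} (G : Graph n) where
  open Graph G using (Adj) renaming (sym to adj-sym)

  AdjEdge : Set
  AdjEdge = Σ[ e ∈ Edge n ] Adj (proj₁ e) (proj₂ e)

  edgesOf : ∀ {u v xs} → Walk G u v xs → List AdjEdge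
  edgesOf here = []
  edgesOf (step {u} {w} adj p) = ((u , w) , adj) ∷ edgesOf p

  module _ (Es : List AdjEdge) where

    toEWalk : ∀ {u v xs} (p : Walk G u v xs) → (∀ {e} → e ∈ edgesOf p → e ∈ Es) →
              Σ[ q ∈ EWalk (map proj₁ Es) u v ] vertices q ≡ xs × AllSteps (λ a c → Consecutive a c xs) q
    toEWalk here _ = ε , refl , tt
    toEWalk (step {u} {w} adj p) p⊆ with toEWalk p (p⊆ ∘ there)
    ... | q , q≡ , steps = inj₂ (inj₁ (∈-map⁺ proj₁ (p⊆ (here refl)))) ◅ q , cong (u ∷_) q≡ ,
                           subst (λ xs → Consecutive u w (u ∷ xs)) q≡ (consecutive-head q) ,
                           allSteps-mono there q steps
      where
      consecutive-head : ∀ {v} (q : EWalk (map proj₁ Es) w v) → Consecutive u w (u ∷ vertices q)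
      consecutive-head ε = here
      consecutive-head (_ ◅ _) = here

    adjacent : ∀ {u v} → (u , v) ∈ map proj₁ Es → Adj u v
    adjacent m with ∈-map⁻ proj₁ m
    ... | (_ , adj) , _ , refl = adj

    -- The subgraph of G formed by Es; unlike G it has decidable adjacency.
    skeleton : Graph n
    skeleton = record
      { Adj = λ u v → ((u , v) ∈ map proj₁ Es ⊎ (v , u) ∈ map proj₁ Es) × u ≢ v
      ; sym = λ { (inj₁ m , u≢v) → inj₂ m , u≢v ∘ sym ; (inj₂ m , u≢v) → inj₁ m , u≢v ∘ sym }
      ; irrefl = λ (_ , u≢u) → u≢u refl }

    skeleton-adj? : ∀ u v → Dec (Graph.Adj skeleton u v)
    skeleton-adj? u v = (edge? (u , v) ⊎-dec edge? (v , u)) ×-dec ¬? (u Fin.≟ v)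
      where
      edge? : ∀ e → Dec (e ∈ map proj₁ Es)
      edge? e = Any.any? (≡-dec Fin._≟_ Fin._≟_ e) (map proj₁ Es)

    skeleton⇒G : ∀ {u v xs} → Walk skeleton u v xs → Walk G u v xs
    skeleton⇒G here = here
    skeleton⇒G (step (inj₁ m , _) p) = step (adjacent m) (skeleton⇒G p)
    skeleton⇒G (step (inj₂ m , _) p) = step (adj-sym (adjacent m)) (skeleton⇒G p)

    private

      walk-source∈ : ∀ {H : Graph n} {u v ys} → Walk H u v ys → u ∈ ys
      walk-source∈ here = here refl
      walk-source∈ (step _ _) = here refl

      suffixPath : ∀ {a v ys} → Walk skeleton a v ys → Unique ys → ∀ {u} → u ∈ ys →
                   Σ[ zs ∈ List (Fin n) ] IsPath skeleton u v zs × (∀ x → x ∈ zs → x ∈ ys)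
      suffixPath here ys! (here refl) = _ , (here , ys!) , λ x m → m
      suffixPath (step adj p) ys! (here refl) = _ , (step adj p , ys!) , λ x m → m
      suffixPath (step adj p) (_ ∷ ys!) (there m) with suffixPath p ys! m
      ... | zs , path , zs⊆ = zs , path , λ x m′ → there (zs⊆ x m′)

    -- Prepending u to a path that already visits u, jump to that visit instead.
    shortcut : ∀ {u v} (p : EWalk (map proj₁ Es) u v) →
               Σ[ ys ∈ List (Fin n) ] IsPath skeleton u v ys × (∀ x → x ∈ ys → x ∈ vertices p)
    shortcut (ε {u}) = u ∷ [] , (here , All.[] ∷ []) , λ x m → m
    shortcut (_◅_ {u} {w} r p) with shortcut p
    ... | ys , (walk , ys!) , ys⊆ with u ∈? ys
    ...   | yes u∈ys =
      let zs , path , zs⊆ = suffixPath walk ys! u∈ys in zs , path , λ x m → there (ys⊆ x (zs⊆ x m))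
    ...   | no u∉ys =
      u ∷ ys , (step (adjacency r) walk , All.tabulate (λ {x} m u≡x → u∉ys (subst (_∈ ys) (sym u≡x) m)) ∷ ys!) ,
      λ { x (here e) → here e ; x (there m) → there (ys⊆ x m) }
      where
      u≢w : u ≢ w
      u≢w u≡w = u∉ys (subst (_∈ ys) (sym u≡w) (walk-source∈ walk))
      adjacency : ReflAdj (map proj₁ Es) u w → Graph.Adj skeleton u w
      adjacency (inj₁ u≡w) = ⊥-elim (u≢w u≡w)
      adjacency (inj₂ a) = a , u≢w

module Skeleton {n : ℕ} (G : Graph n) {k′ : ℕ} (G-connected : KConnected G (2 * suc k′))
  (rooted : ∀ v → RootedSubdivK G (3 * suc k′ ∸ 1) v)
  (s t : Fin (suc k′) → Fin n) (s-inj : Injective _≡_ _≡_ s) (t-inj : Injective _≡_ _≡_ t)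
  (s≢t : ∀ i j → s i ≢ t j) where

  open Graph G using (Adj)

  k m : ℕ
  k = suc k′
  m = 3 * k ∸ 1

  m≡ : m ≡ (k + k) + k′
  m≡ = trans (ℕ.+-comm k′ _) (cong (λ x → (k + x) + k′) (ℕ.+-identityʳ k))

  open SubdivK (proj₁ (rooted (s zero)))

  r : Fin m
  r = proj₁ (proj₂ (rooted (s zero)))

  b-r≡s₀ : b r ≡ s zero
  b-r≡s₀ = proj₁ (proj₂ (proj₂ (rooted (s zero))))

  s₀-adj : ∀ i → i ≢ r → Adj (s zero) (b i)
  s₀-adj = proj₂ (proj₂ (proj₂ (rooted (s zero))))

  module _ (C : Subset n) (u v : Fin n) where

    connectionEdges : Dec (∣ C ∣ < 2 * k) → Dec (u Subset.∈ C) → Dec (v Subset.∈ C) → List (AdjEdge G)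
    connectionEdges (yes |C|<2k) (no u∉C) (no v∉C) =
      edgesOf G (proj₁ (proj₁ (proj₂ (proj₂ G-connected C |C|<2k u v u∉C v∉C))))
    connectionEdges _ _ _ = []

  connectionEdges? : Subset n → Fin n → Fin n → List (AdjEdge G)
  connectionEdges? C u v = connectionEdges C u v (∣ C ∣ ℕ.<? 2 * k) (u Subset.∈? C) (v Subset.∈? C)

  pathEdges : ∀ i j → Dec (i Fin.< j) → List (AdjEdge G)
  pathEdges i j (yes i<j) = edgesOf G (proj₁ (P-path i j i<j))
  pathEdges i j (no _) = []

  pathEdges? : Fin m → Fin m → List (AdjEdge G)
  pathEdges? i j = pathEdges i j (i Fin.<? j)

  rootEdges : ∀ i → Dec (i ≡ r) → List (AdjEdge G)
  rootEdges i (yes _) = []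
  rootEdges i (no i≢r) = ((s zero , b i) , s₀-adj i i≢r) ∷ []

  rootEdges? : Fin m → List (AdjEdge G)
  rootEdges? i = rootEdges i (i Fin.≟ r)

  connectionEs pathEs rootEs Es : List (AdjEdge G)
  connectionEs =
    concatMap (λ C → concatMap (λ u → concatMap (connectionEdges? C u) (allFin n)) (allFin n)) (subsets n)
  pathEs = concatMap (λ i → concatMap (pathEdges? i) (allFin m)) (allFin m)
  rootEs = concatMap rootEdges? (allFin m)
  Es = connectionEs ++ pathEs ++ rootEs

  E : List (Edge n)
  E = map proj₁ Es

  private
    ∈-concatMap³ : ∀ {A B C D : Set} {f : A → B → C → List D} {as bs cs a b c d} →
                   a ∈ as → b ∈ bs → c ∈ cs → d ∈ f a b c →
                   d ∈ concatMap (λ a → concatMap (λ b → concatMap (λ c → f a b c) cs) bs) as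
    ∈-concatMap³ a∈ b∈ c∈ d∈ = ∈-concatMap⁺ a∈ (∈-concatMap⁺ b∈ (∈-concatMap⁺ c∈ d∈))

  connected : ∀ S → length S < k + k → ∀ u v → u ∉ S → v ∉ S → Σ[ p ∈ EWalk E u v ] Avoids (_∈ S) p
  connected S |S|<K u v u∉S v∉S with witness (∣ C ∣ ℕ.<? 2 * k) (u Subset.∈? C) (v Subset.∈? C)
    where
    C : Subset n
    C = toSubset S
    |C|<2k : ∣ C ∣ < 2 * k
    |C|<2k = ℕ.≤-<-trans (∣toSubset∣≤length S)
               (subst (length S <_) (cong (k +_) (sym (ℕ.+-identityʳ k))) |S|<K)
    witness : ∀ d₁ d₂ d₃ → Σ[ xs ∈ List (Fin n) ] Σ[ p ∈ Walk G u v xs ]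
                (∀ x → x ∈ xs → x Subset.∉ C) ×
                (∀ {e} → e ∈ edgesOf G p → e ∈ connectionEdges C u v d₁ d₂ d₃)
    witness (yes |C|<2k′) (no u∉C) (no v∉C) =
      let xs , (p , _) , avoids = proj₂ G-connected C |C|<2k′ u v u∉C v∉C in xs , p , avoids , λ e∈ → e∈
    witness (no ¬|C|<2k) _ _ = ⊥-elim (¬|C|<2k |C|<2k)
    witness (yes _) (yes u∈C) _ = ⊥-elim (u∉S (∈-toSubset⁻ S u∈C))
    witness (yes _) (no _) (yes v∈C) = ⊥-elim (v∉S (∈-toSubset⁻ S v∈C))
  ... | xs , p , avoids , edges⊆ =
    let q , q≡ , _ = toEWalk G Es p λ e∈ → ∈-++⁺ˡ (∈-concatMap³ {f = connectionEdges?}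
                       (∈-subsets (toSubset S)) (∈-allFin u) (∈-allFin v) (edges⊆ e∈))
    in q , λ x m x∈S → avoids x (subst (x ∈_) q≡ m) (∈-toSubset⁺ S x∈S)

  P-walk : ∀ i j → i Fin.< j → Σ[ q ∈ EWalk E (b i) (b j) ]
             vertices q ≡ P i j × AllSteps (λ u w → Consecutive u w (P i j)) q
  P-walk i j i<j = toEWalk G Es (proj₁ path) λ e∈ → ∈-++⁺ʳ connectionEs (∈-++⁺ˡ
    (∈-concatMap⁺ {f = λ i → concatMap (pathEdges? i) (allFin m)} (∈-allFin i)
      (∈-concatMap⁺ {f = pathEdges? i} (∈-allFin j) (proj₂ path e∈))))
    where
    recorded : ∀ d → Σ[ p ∈ Walk G (b i) (b j) (P i j) ] (∀ {e} → e ∈ edgesOf G p → e ∈ pathEdges i j d)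
    recorded (yes i<j′) = proj₁ (P-path i j i<j′) , λ e∈ → e∈
    recorded (no i≮j) = ⊥-elim (i≮j i<j)
    path = recorded (i Fin.<? j)

  root-adj : ∀ i → i ≢ r → ReflAdj E (s zero) (b i)
  root-adj i i≢r = inj₂ (inj₁ (∈-map⁺ proj₁ (∈-++⁺ʳ connectionEs (∈-++⁺ʳ pathEs
    (∈-concatMap⁺ {f = rootEdges?} (∈-allFin i) (proj₂ (recorded (i Fin.≟ r))))))))
    where
    recorded : ∀ d → Σ[ adj ∈ Adj (s zero) (b i) ] ((s zero , b i) , adj) ∈ rootEdges i d
    recorded (yes i≡r) = ⊥-elim (i≢r i≡r)
    recorded (no i≢r′) = s₀-adj i i≢r′ , here refl

  open Linking E s t s-inj t-inj s≢t m≡ b (λ {i} {j} → b-inj i j) P P-ends P-disj P-walk r b-r≡s₀ root-adj connected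
    using (linking)

  shortcuts : ∀ L → Disjoint L → Σ (Fin k → List (Fin n)) (DisjointPaths (skeleton G Es) s t)
  shortcuts L disjoint = (λ i → proj₁ (shortcut G Es (L i))) , (λ i → proj₁ (proj₂ (shortcut G Es (L i)))) ,
    λ i j i≢j x m m′ → disjoint i j i≢j x (proj₂ (proj₂ (shortcut G Es (L i))) x m)
                                          (proj₂ (proj₂ (shortcut G Es (L j))) x m′)

  -- Linkedness in the finite skeleton is decidable, so the double negation can be removed.
  skeletonPaths : Σ (Fin k → List (Fin n)) (DisjointPaths (skeleton G Es) s t)
  skeletonPaths = decidable-stable (linkage? (skeleton G Es) (skeleton-adj? G Es) s t)
    λ ¬paths → linking λ (L , disjoint) → ¬paths (shortcuts L disjoint)

  disjointPaths : Σ (Fin k → List (Fin n)) (DisjointPaths G s t)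
  disjointPaths = let L , paths , disjoint = skeletonPaths in
    L , (λ i → skeleton⇒G G Es (proj₁ (paths i)) , proj₂ (paths i)) , disjoint

lemma2p1 : ∀ {n : ℕ} (G : Graph n) (k : ℕ) → 1 ≤ k →
    KConnected G (2 * k) →
    (∀ (v : Fin n) → RootedSubdivK G (3 * k ∸ 1) v) →
    KLinked G k
lemma2p1 {n} G (suc k′) _ G-connected rooted =
  subst (_≤ n) (ℕ.*-comm 2 (suc k′)) (ℕ.<⇒≤ (proj₁ G-connected)) ,
  λ s t s-inj t-inj s≢t → Skeleton.disjointPaths G G-connected rooted s t (s-inj _ _) (t-inj _ _) s≢t
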